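{- Let $d$ be a positive integer and let $(\widetilde{\mathcal{S}}_d(m))_{m\in\mathbb{Z}^+}$ be an Eulerian simplex family of dimension $d$. Then $$i(\widetilde{\mathcal{S}}_d(m),t)=mt^d+c_{d-1}t^{d-1}+\cdots+c_1t+1,$$ where $c_{d-1},\ldots,c_1$ are constants independent of $m$.
   Context: For a $d$-dimensional integral polytope $\mathcal{P}\subset\mathbb{R}^d$, $i(\mathcal{P},t)$ is its Ehrhart polynomial ($i(\mathcal{P},t)=\#(t\mathcal{P}\cap\mathbb{Z}^d)$ for positive integers $t$) and its $h^*$-polynomial is defined by $1+\sum_{t\geq1}i(\mathcal{P},t)x^t=h^*_{\mathcal{P}}(x)/(1-x)^{d+1}$. The Eulerian polynomial is $A_d(x)=\sum_{\pi\in\mathfrak{S}_d}x^{1+\mathrm{des}(\pi)}$, where $\mathrm{des}(\pi)$ is the number of descents $\pi_j>\pi_{j+1}$ of the permutation $\pi$. A parameterized family $(\mathcal{R}_d(m))_{m\in\mathbb{Z}^+}$ of $d$-dimensional integral simplices in $\mathbb{R}^d$ is an Eulerian simplex family of dimension $d$ if $h^*_{\mathcal{R}_d(m)}(x)=mA_d(x)+T(x)$ for a polynomial $T(x)$ independent of $m$ with $T(1)=0$ and $\deg T\leq d$. -}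

module Defs where

open import Data.Nat as ℕ using (ℕ; zero; suc)
open import Data.Nat.Combinatorics using (_C_)
open import Data.Integer as ℤ using (ℤ; +_)
open import Data.Rational as ℚ using (ℚ; 0ℚ; 1ℚ)
open import Data.Fin using (Fin; zero; suc)
open import Data.Vec using (Vec; lookup)
open import Data.List using (List; []; _∷_; length; upTo)
open import Data.List.Relation.Unary.All using (All)
open import Data.List.Relation.Unary.Unique.Propositional using (Unique)
open import Data.List.Membership.Propositional using (_∈_)
open import Data.List.Relation.Binary.Permutation.Propositional using (_↭_)
open import Data.Bool using (true; false; if_then_else_)
open import Data.Product using (Σ; _×_)
open import Relation.Binary.PropositionalEquality using (_≡_)

sumFinℚ : (n : ℕ) → (Fin n → ℚ) → ℚ
sumFinℚ zero    f = 0ℚ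
sumFinℚ (suc n) f = f zero ℚ.+ sumFinℚ n (λ i → f (suc i))

sumUpToℤ : ℕ → (ℕ → ℤ) → ℤ
sumUpToℤ zero    f = f 0
sumUpToℤ (suc k) f = sumUpToℤ k f ℤ.+ f (suc k)

sum1Toℚ : ℕ → (ℕ → ℚ) → ℚ
sum1Toℚ zero    f = 0ℚ
sum1Toℚ (suc k) f = sum1Toℚ k f ℚ.+ f (suc k)

ℤtoℚ : ℤ → ℚ
ℤtoℚ z = z ℚ./ 1

ℕtoℚ : ℕ → ℚ
ℕtoℚ n = (+ n) ℚ./ 1

HasCount : {A : Set} → (A → Set) → ℕ → Set
HasCount {A} P N =
  Σ (List A) λ xs → Unique xs × All P xs × (∀ x → P x → x ∈ xs) × length xs ≡ N

-- Integral simplices in ℝ^d, given by their d+1 vertices in ℤ^d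

Point : ℕ → Set
Point d = Vec ℤ d

Simplex : ℕ → Set
Simplex d = Fin (suc d) → Point d

-- the simplex is d-dimensional: v₁ - v₀, …, v_d - v₀ are linearly
-- independent over ℚ (equivalently, the vertices are affinely independent)
IsFullDim : {d : ℕ} → Simplex d → Set
IsFullDim {d} v =
  (λc : Fin d → ℚ) →
  (∀ (k : Fin d) →
     sumFinℚ d (λ i → λc i ℚ.* ℤtoℚ (lookup (v (suc i)) k ℤ.- lookup (v zero) k)) ≡ 0ℚ) →
  ∀ i → λc i ≡ 0ℚ

InDilate : {d : ℕ} → Simplex d → ℕ → Point d → Set
InDilate {d} v t x =
  Σ (Fin (suc d) → ℚ) λ lam →
    (∀ i → 0ℚ ℚ.≤ lam i) ×
    sumFinℚ (suc d) lam ≡ 1ℚ ×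
    (∀ (k : Fin d) →
       sumFinℚ (suc d) (λ i → lam i ℚ.* ℤtoℚ (+ t ℤ.* lookup (v i) k)) ≡ ℤtoℚ (lookup x k))

IsEhrhartValue : {d : ℕ} → Simplex d → ℕ → ℕ → Set
IsEhrhartValue v t N = HasCount (InDilate v t) N

-- Given L : ℕ → ℕ with L t = i(P,t) for t ≥ 1, the series
-- 1 + Σ_{t≥1} L t x^t equals h*(x)/(1-x)^{d+1}, i.e.
-- h*(x) = (1-x)^{d+1} (1 + Σ_{t≥1} L t x^t); its k-th coefficient is
-- Σ_{j=0}^{k} (-1)^j C(d+1,j) L'(k-j), with L'(0) = 1, L'(t) = L t.

ehrSeries : (ℕ → ℕ) → ℕ → ℤ
ehrSeries L zero    = + 1
ehrSeries L (suc t) = + L (suc t)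

signℤ : ℕ → ℤ
signℤ zero    = + 1
signℤ (suc j) = ℤ.- signℤ j

hstarCoeff : ℕ → (ℕ → ℕ) → ℕ → ℤ
hstarCoeff d L k =
  sumUpToℤ k (λ j → signℤ j ℤ.* (+ (suc d C j)) ℤ.* ehrSeries L (k ℕ.∸ j))

-- Eulerian polynomial A_d(x) = Σ_{π ∈ S_d} x^{1 + des π}.
-- Permutations of {0,…,d-1} are represented as lists π with π ↭ [0,…,d-1].

desFrom : ℕ → List ℕ → ℕ
desFrom a []       = 0
desFrom a (b ∷ xs) = (if b ℕ.<ᵇ a then 1 else 0) ℕ.+ desFrom b xs

des : List ℕ → ℕ
des []       = 0
des (a ∷ xs) = desFrom a xs

IsEulerianCoeff : ℕ → ℕ → ℕ → Set
IsEulerianCoeff d k N = HasCount (λ (π : List ℕ) → (π ↭ upTo d) × suc (des π) ≡ k) N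

-- R m (m ≥ 1) are d-dimensional integral simplices, i m t = i(R m, t) (t ≥ 1),
-- a k = [x^k] A_d(x).  The family is Eulerian if h*_{R m}(x) = m A_d(x) + T(x)
-- with T independent of m, deg T ≤ d, T(1) = 0.

IsEulerianSimplexFamily : (d : ℕ) → (ℕ → Simplex d) → (ℕ → ℕ → ℕ) → (ℕ → ℕ) → Set
IsEulerianSimplexFamily d R i a =
  (∀ m → 1 ℕ.≤ m → IsFullDim (R m)) ×
  Σ (ℕ → ℤ) λ T →
    (∀ k → d ℕ.< k → T k ≡ + 0) ×
    sumUpToℤ d T ≡ + 0 ×
    (∀ m → 1 ℕ.≤ m → ∀ k → hstarCoeff d (i m) k ≡ (+ m) ℤ.* (+ a k) ℤ.+ T k)

module Submission where

-- The Ehrhart series of a d-simplex is h*(x) / (1 − x)^(d+1), so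
-- i(t) = ∑ₖ h*ₖ C(t + d − k, d); here h* is recovered from the Ehrhart values as their
-- (d+1)-st finite difference.  For h* = m A_d + T this splits into
-- m ∑ₖ A(d,k) C(t + d − k, d) = m tᵈ, by Worpitzky's identity (proved by inserting the
-- largest letter into permutations), plus ∑ₖ Tₖ C(t + d − k, d), a polynomial in t that does
-- not depend on m.  Its tᵈ-coefficient is T(1)/d! = 0, and its constant term is T₀ = h*₀ = 1
-- because A_d has no constant term.

module Counting where

  open import Defs using (HasCount)
  open import Data.List using ([])
  open import Data.List.Relation.Unary.All as All using ([])
  open import Data.List.Relation.Unary.AllPairs using ([])
  open import Data.List.Membership.Propositional.Properties.WithK using (unique∧set⇒bag)
  open import Data.List.Relation.Binary.BagAndSetEquality using (∼bag⇒↭)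
  open import Data.List.Relation.Binary.Permutation.Propositional.Properties using (↭-length)
  open import Data.Product using (_,_)
  open import Data.Empty using (⊥-elim)
  open import Function.Bundles using (mk⇔)
  open import Relation.Nullary using (¬_)
  open import Relation.Binary.PropositionalEquality using (_≡_; refl)

  HasCount-unique : ∀ {A : Set} {P : A → Set} {m n} → HasCount P m → HasCount P n → m ≡ n
  HasCount-unique (xs , xs! , Pxs , ∈xs , refl) (ys , ys! , Pys , ∈ys , refl) =
    ↭-length (∼bag⇒↭ (unique∧set⇒bag xs! ys! (mk⇔ (λ x∈xs → ∈ys _ (All.lookup Pxs x∈xs))
                                                   (λ x∈ys → ∈xs _ (All.lookup Pys x∈ys)))))

  HasCount-empty : ∀ {A : Set} {P : A → Set} {n} → (∀ x → ¬ P x) → HasCount P n → n ≡ 0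
  HasCount-empty ¬P count = HasCount-unique count ([] , [] , [] , (λ x Px → ⊥-elim (¬P x Px)) , refl)

module Permutations where

  open import Data.Nat using (ℕ; zero; suc; _<_; _<?_)
  open import Data.Nat.Properties using (<-irrefl; ≤-refl)
  open import Data.List using (List; []; _∷_; [_]; _++_; map; concatMap; filter; length; upTo)
  open import Data.List.Properties using (filter-accept; filter-reject; filter-all; ∷-injectiveˡ; ∷-injectiveʳ; upTo-∷ʳ; length-upTo; ++-identityʳ)
  open import Data.List.Relation.Unary.All as All using (All; []; _∷_)
  open import Data.List.Relation.Unary.Any using (here; there)
  open import Data.List.Relation.Unary.AllPairs using ([]; _∷_)
  open import Data.List.Relation.Unary.Unique.Propositional using (Unique)
  open import Data.List.Relation.Unary.Unique.Propositional.Properties using (++⁺; map⁺)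
  open import Data.List.Membership.Propositional using (_∈_; find; lose)
  open import Data.List.Membership.Propositional.Properties
    using (∈-map⁺; ∈-map⁻; ∈-concatMap⁺; ∈-concatMap⁻; ∈-∃++; ∈-upTo⁺; ∈-upTo⁻)
  open import Data.List.Relation.Binary.Permutation.Propositional using (_↭_; ↭-refl; ↭-sym; ↭-trans; ↭-reflexive; ↭-prep; ↭-swap)
  open import Data.List.Relation.Binary.Permutation.Propositional.Properties using (∈-resp-↭; ∷↭∷ʳ; drop-mid; ↭-length)
  open import Data.Product using (_,_; _×_)
  open import Relation.Nullary using (¬_)
  open import Relation.Binary.PropositionalEquality using (_≡_; _≢_; refl; sym; trans; cong)

  insertions : ℕ → List ℕ → List (List ℕ)
  insertions x []       = [ [ x ] ]
  insertions x (y ∷ ys) = (x ∷ y ∷ ys) ∷ map (y ∷_) (insertions x ys)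

  permutations : ℕ → List (List ℕ)
  permutations zero    = [ [] ]
  permutations (suc d) = concatMap (insertions d) (permutations d)

  ∈-insertions⇒↭ : ∀ {x π l} → l ∈ insertions x π → l ↭ x ∷ π
  ∈-insertions⇒↭ {π = []}     (here refl) = ↭-refl
  ∈-insertions⇒↭ {π = y ∷ ys} (here refl) = ↭-refl
  ∈-insertions⇒↭ {x} {y ∷ ys} (there l∈) with l′ , l′∈ , refl ← ∈-map⁻ (y ∷_) l∈ =
    ↭-trans (↭-prep y (∈-insertions⇒↭ l′∈)) (↭-swap y x ↭-refl)

  ++-∈-insertions : ∀ x pre suf → pre ++ x ∷ suf ∈ insertions x (pre ++ suf)
  ++-∈-insertions x []        []      = here refl
  ++-∈-insertions x []        (_ ∷ _) = here refl
  ++-∈-insertions x (y ∷ pre) suf     = there (∈-map⁺ (y ∷_) (++-∈-insertions x pre suf))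

  ∈-permutations⇒↭ : ∀ {d π} → π ∈ permutations d → π ↭ upTo d
  ∈-permutations⇒↭ {zero}  (here refl) = ↭-refl
  ∈-permutations⇒↭ {suc d} π∈ with π′ , π′∈ , π∈ins ← find (∈-concatMap⁻ (insertions d) {xs = permutations d} π∈) =
    ↭-trans (∈-insertions⇒↭ π∈ins)
   (↭-trans (↭-prep d (∈-permutations⇒↭ π′∈))
   (↭-trans (∷↭∷ʳ d (upTo d)) (↭-reflexive (upTo-∷ʳ d))))

  ↭⇒∈-permutations : ∀ {d π} → π ↭ upTo d → π ∈ permutations d
  ↭⇒∈-permutations {zero}  {[]}    _ = here refl
  ↭⇒∈-permutations {zero}  {_ ∷ _} p with () ← ↭-length p
  ↭⇒∈-permutations {suc d} p
    with pre , suf , refl ← ∈-∃++ (∈-resp-↭ (↭-sym p) (∈-upTo⁺ {suc d} ≤-refl)) =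
    ∈-concatMap⁺ (insertions d) {xs = permutations d} (lose (↭⇒∈-permutations rest↭) (++-∈-insertions d pre suf))
    where
    rest↭ : pre ++ suf ↭ upTo d
    rest↭ = ↭-trans (drop-mid pre (upTo d) (↭-trans p (↭-reflexive (sym (upTo-∷ʳ d)))))
                    (↭-reflexive (++-identityʳ (upTo d)))

  ∈-permutations⇒< : ∀ {d π} → π ∈ permutations d → All (_< d) π
  ∈-permutations⇒< π∈ = All.tabulate (λ x∈π → ∈-upTo⁻ (∈-resp-↭ (∈-permutations⇒↭ π∈) x∈π))

  ∈-permutations⇒length : ∀ {d π} → π ∈ permutations d → length π ≡ d
  ∈-permutations⇒length {d} π∈ = trans (↭-length (∈-permutations⇒↭ {d} π∈)) (length-upTo d)

  filter-<-insertions : ∀ {x π l} → All (_< x) π → l ∈ insertions x π → filter (_<? x) l ≡ π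
  filter-<-insertions {x} {[]}     _ (here refl) = filter-reject (_<? x) (<-irrefl refl)
  filter-<-insertions {x} {y ∷ ys} π<x (here refl) =
    trans (filter-reject (_<? x) (<-irrefl refl)) (filter-all (_<? x) π<x)
  filter-<-insertions {x} {y ∷ ys} (y<x ∷ ys<x) (there l∈) with l′ , l′∈ , refl ← ∈-map⁻ (y ∷_) l∈ =
    trans (filter-accept (_<? x) y<x) (cong (y ∷_) (filter-<-insertions ys<x l′∈))

  insertions-unique : ∀ {x π} → All (_< x) π → Unique (insertions x π)
  insertions-unique {π = []}     []           = [] ∷ []
  insertions-unique {x} {y ∷ ys} (y<x ∷ ys<x) =
    All.tabulate head≢ ∷ map⁺ ∷-injectiveʳ (insertions-unique ys<x)
    where
    head≢ : ∀ {l} → l ∈ map (y ∷_) (insertions x ys) → x ∷ y ∷ ys ≢ l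
    head≢ l∈ eq with _ , _ , refl ← ∈-map⁻ (y ∷_) l∈ = <-irrefl (sym (∷-injectiveˡ eq)) y<x

  concatMap-insertions-unique : ∀ {x ps} → Unique ps → All (All (_< x)) ps →
                                Unique (concatMap (insertions x) ps)
  concatMap-insertions-unique {ps = []}        []            []            = []
  concatMap-insertions-unique {x} {π ∷ ps} (π∉ps ∷ ps!) (π<x ∷ ps<x) =
    ++⁺ (insertions-unique π<x) (concatMap-insertions-unique ps! ps<x) disjoint
    where
    disjoint : ∀ {l} → ¬ (l ∈ insertions x π × l ∈ concatMap (insertions x) ps)
    disjoint (l∈π , l∈ps) with π′ , π′∈ps , l∈π′ ← find (∈-concatMap⁻ (insertions x) {xs = ps} l∈ps) =
      All.lookup π∉ps π′∈ps
        (trans (sym (filter-<-insertions π<x l∈π)) (filter-<-insertions (All.lookup ps<x π′∈ps) l∈π′))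

  permutations-unique : ∀ d → Unique (permutations d)
  permutations-unique zero    = [] ∷ []
  permutations-unique (suc d) =
    concatMap-insertions-unique (permutations-unique d) (All.tabulate ∈-permutations⇒<)

module Binomials where

  open import Data.Nat using (ℕ; zero; suc; _+_; _*_; _∸_)
  open import Data.Nat.Properties using (*-zeroʳ; *-identityˡ; *-identityʳ)
  open import Data.Nat.Combinatorics using (_C_; nCk+nC[k+1]≡[n+1]C[k+1]; nC1≡n)
  open import Data.Nat.Tactic.RingSolver using (solve-∀)
  open import Relation.Binary.PropositionalEquality
  open ≡-Reasoning

  -- The Ehrhart function of the series xᵏ / (1 − x)^(d+1), i.e. the contribution of h*ₖ.
  -- For k ≤ d the truncated subtraction is harmless: if t < k then t + d ∸ k < d.
  ehrhartBasis : ℕ → ℕ → ℕ → ℕ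
  ehrhartBasis d k t = (t + d ∸ k) C d

  [k+1]*[n+1]C[k+1]≡[n+1]*nCk : ∀ n k → suc k * (suc n C suc k) ≡ suc n * (n C k)
  [k+1]*[n+1]C[k+1]≡[n+1]*nCk zero    zero    = refl
  [k+1]*[n+1]C[k+1]≡[n+1]*nCk zero    (suc k) = *-zeroʳ (suc (suc k))
  [k+1]*[n+1]C[k+1]≡[n+1]*nCk (suc n) zero    = trans (*-identityˡ _) (trans (nC1≡n (suc (suc n))) (sym (*-identityʳ _)))
  [k+1]*[n+1]C[k+1]≡[n+1]*nCk (suc n) (suc k) = begin
    suc (suc k) * (suc (suc n) C suc (suc k))
      ≡⟨ cong (suc (suc k) *_) (nCk+nC[k+1]≡[n+1]C[k+1] (suc n) (suc k)) ⟨
    suc (suc k) * (suc n C suc k + suc n C suc (suc k))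
      ≡⟨ lemma₁ k (suc n C suc k) (suc n C suc (suc k)) ⟩
    suc k * (suc n C suc k) + suc n C suc k + suc (suc k) * (suc n C suc (suc k))
      ≡⟨ cong₂ (λ u v → u + suc n C suc k + v) ([k+1]*[n+1]C[k+1]≡[n+1]*nCk n k) ([k+1]*[n+1]C[k+1]≡[n+1]*nCk n (suc k)) ⟩
    suc n * (n C k) + suc n C suc k + suc n * (n C suc k)
      ≡⟨ cong (λ u → suc n * (n C k) + u + suc n * (n C suc k)) (nCk+nC[k+1]≡[n+1]C[k+1] n k) ⟨
    suc n * (n C k) + (n C k + n C suc k) + suc n * (n C suc k)
      ≡⟨ lemma₂ n (n C k) (n C suc k) ⟩
    suc (suc n) * (n C k + n C suc k)
      ≡⟨ cong (suc (suc n) *_) (nCk+nC[k+1]≡[n+1]C[k+1] n k) ⟩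
    suc (suc n) * (suc n C suc k) ∎
    where
    lemma₁ : ∀ k a b → suc (suc k) * (a + b) ≡ suc k * a + a + suc (suc k) * b
    lemma₁ = solve-∀
    lemma₂ : ∀ n a b → suc n * a + (a + b) + suc n * b ≡ suc (suc n) * (a + b)
    lemma₂ = solve-∀

module Worpitzky where

  open import Defs using (desFrom; des)
  open Permutations
  open Binomials
  open import Data.Nat using (ℕ; zero; suc; _+_; _*_; _∸_; _^_; _≤_; _<_; z≤n; s≤s; _<ᵇ_; _<?_)
  open import Data.Nat.Properties
    using (≤-refl; ≤-trans; <⇒≤; ≮⇒≥; ≤⇒≯; <⇒<ᵇ; <ᵇ⇒<; +-mono-≤; m≤n⇒m≤1+n; m≤n+m; +-suc; +-assoc;
           +-∸-assoc; m+[n∸m]≡n; +-cancelʳ-≡; *-zeroʳ; *-distribˡ-+)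
  open import Data.Nat.Combinatorics using (_C_; nCk+nC[k+1]≡[n+1]C[k+1])
  open import Data.Nat.Tactic.RingSolver using (solve-∀)
  open import Data.Bool using (true; false; if_then_else_)
  open import Data.Unit using (tt)
  open import Data.List using (List; []; _∷_; _++_; map; length; upTo; concatMap)
  open import Data.List.Properties using (map-∘; map-cong; map-cong-local; map-++; length-upTo)
  open import Data.List.Membership.Propositional using (_∈_)
  open import Data.Nat.ListAction using (sum)
  open import Data.Nat.ListAction.Properties using (sum-++)
  open import Data.List.Relation.Unary.All as All using (All; []; _∷_)
  open import Data.List.Relation.Binary.Permutation.Propositional using (_↭_)
  open import Data.List.Relation.Binary.Permutation.Propositional.Properties using (↭-length)
  open import Function using (_∘_)
  open import Relation.Nullary using (yes; no; contradiction)
  open import Relation.Binary.PropositionalEquality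
  open ≡-Reasoning

  sum-map-*ˡ : ∀ {A : Set} c (f : A → ℕ) xs → sum (map (λ x → c * f x) xs) ≡ c * sum (map f xs)
  sum-map-*ˡ c f []       = sym (*-zeroʳ c)
  sum-map-*ˡ c f (x ∷ xs) = trans (cong (c * f x +_) (sum-map-*ˡ c f xs)) (sym (*-distribˡ-+ c (f x) _))

  sum-map-concatMap : ∀ {A B : Set} (f : B → ℕ) (g : A → List B) xs →
                      sum (map f (concatMap g xs)) ≡ sum (map (λ x → sum (map f (g x))) xs)
  sum-map-concatMap f g []       = refl
  sum-map-concatMap f g (x ∷ xs) = begin
    sum (map f (g x ++ concatMap g xs))               ≡⟨ cong sum (map-++ f (g x) _) ⟩
    sum (map f (g x) ++ map f (concatMap g xs))       ≡⟨ sum-++ (map f (g x)) _ ⟩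
    sum (map f (g x)) + sum (map f (concatMap g xs))  ≡⟨ cong (sum (map f (g x)) +_) (sum-map-concatMap f g xs) ⟩
    sum (map f (g x)) + sum (map (λ x → sum (map f (g x))) xs) ∎

  desFrom-descent : ∀ {a b} l → b < a → desFrom a (b ∷ l) ≡ suc (desFrom b l)
  desFrom-descent {a} {b} l b<a with b <ᵇ a | <⇒<ᵇ b<a
  ... | true  | _  = refl
  ... | false | ()

  desFrom-ascent : ∀ {a b} l → a ≤ b → desFrom a (b ∷ l) ≡ desFrom b l
  desFrom-ascent {a} {b} l a≤b with b <ᵇ a | <ᵇ⇒< b a
  ... | false | _   = refl
  ... | true  | b<a = contradiction (b<a tt) (≤⇒≯ a≤b)

  desFrom≤length : ∀ a l → desFrom a l ≤ length l
  desFrom≤length a []      = z≤n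
  desFrom≤length a (b ∷ l) = +-mono-≤ (indicator≤1 (b <ᵇ a)) (desFrom≤length b l)
    where
    indicator≤1 : ∀ x → (if x then 1 else 0) ≤ 1
    indicator≤1 true  = ≤-refl
    indicator≤1 false = z≤n

  des≤length : ∀ π → des π ≤ length π
  des≤length []      = z≤n
  des≤length (a ∷ l) = m≤n⇒m≤1+n (desFrom≤length a l)

  ↭-upTo⇒suc-des≤ : ∀ {d π} → π ↭ upTo (suc d) → suc (des π) ≤ suc d
  ↭-upTo⇒suc-des≤ {d} {[]}    π↭ with () ← ↭-length π↭
  ↭-upTo⇒suc-des≤ {d} {a ∷ l} π↭ = subst (suc (desFrom a l) ≤_) (trans (↭-length π↭) (length-upTo (suc d)))
                                          (s≤s (desFrom≤length a l))

  private
    count-step-ascent : ∀ s n σ u v → σ + s * v ≡ suc s * u + n * v →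
                        v + σ + s * v ≡ suc s * u + suc n * v
    count-step-ascent s n σ u v ih = begin
      v + σ + s * v         ≡⟨ +-assoc v σ (s * v) ⟩
      v + (σ + s * v)       ≡⟨ cong (v +_) ih ⟩
      v + (suc s * u + n * v) ≡⟨ lemma s n u v ⟩
      suc s * u + suc n * v ∎
      where
      lemma : ∀ s n u v → v + (suc s * u + n * v) ≡ suc s * u + suc n * v
      lemma = solve-∀

    count-step-descent : ∀ s n σ u v → σ + s * v ≡ suc s * u + n * v →
                         u + σ + suc s * v ≡ suc (suc s) * u + suc n * v
    count-step-descent s n σ u v ih = begin
      u + σ + suc s * v            ≡⟨ lemma₁ u σ s v ⟩
      u + (σ + s * v) + v          ≡⟨ cong (λ w → u + w + v) ih ⟩
      u + (suc s * u + n * v) + v  ≡⟨ lemma₂ u s n v ⟩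
      suc (suc s) * u + suc n * v  ∎
      where
      lemma₁ : ∀ u σ s v → u + σ + suc s * v ≡ u + (σ + s * v) + v
      lemma₁ = solve-∀
      lemma₂ : ∀ u s n v → u + (suc s * u + n * v) + v ≡ suc (suc s) * u + suc n * v
      lemma₂ = solve-∀

  sum-insertions-head : ∀ (f : ℕ → ℕ) {a b x} zs → a < x → b < x →
    sum (map (f ∘ desFrom a) (insertions x (b ∷ zs)))
      ≡ f (suc (desFrom b zs)) + sum (map (f ∘ desFrom a ∘ (b ∷_)) (insertions x zs))
  sum-insertions-head f {a} {b} {x} zs a<x b<x =
    cong₂ (λ u τ → f u + sum τ) (trans (desFrom-ascent (b ∷ zs) (<⇒≤ a<x)) (desFrom-descent zs b<x))
                                (sym (map-∘ (insertions x zs)))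

  -- Insert a new maximum x into the gaps of a ∷ ys after a: the gaps behind the s descents
  -- and the final gap keep s descents, the other length ys − s gaps create one more.
  sum-desFrom-insertions : ∀ (f : ℕ → ℕ) {a x} ys → a < x → All (_< x) ys →
    sum (map (f ∘ desFrom a) (insertions x ys)) + desFrom a ys * f (suc (desFrom a ys))
      ≡ suc (desFrom a ys) * f (desFrom a ys) + length ys * f (suc (desFrom a ys))
  sum-desFrom-insertions f {a} {x} [] a<x [] =
    cong (λ s → f s + 0 + 0) (desFrom-ascent [] (<⇒≤ a<x))
  sum-desFrom-insertions f {a} {x} (b ∷ zs) a<x (b<x ∷ zs<x) with b <? a
  ... | yes b<a = begin
    sum (map (f ∘ desFrom a) (insertions x (b ∷ zs))) + desFrom a (b ∷ zs) * f (suc (desFrom a (b ∷ zs)))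
      ≡⟨ cong₂ (λ σ s → σ + s * f (suc s)) σ≡ (desFrom-descent zs b<a) ⟩
    f (suc s) + σ + suc s * f (suc (suc s))
      ≡⟨ count-step-descent s (length zs) σ _ _ (sum-desFrom-insertions (f ∘ suc) zs b<x zs<x) ⟩
    suc (suc s) * f (suc s) + suc (length zs) * f (suc (suc s))
      ≡⟨ cong (λ s′ → suc s′ * f s′ + suc (length zs) * f (suc s′)) (desFrom-descent zs b<a) ⟨
    suc (desFrom a (b ∷ zs)) * f (desFrom a (b ∷ zs)) + suc (length zs) * f (suc (desFrom a (b ∷ zs))) ∎
    where
    s σ : ℕ
    s = desFrom b zs
    σ = sum (map (f ∘ suc ∘ desFrom b) (insertions x zs))
    σ≡ : sum (map (f ∘ desFrom a) (insertions x (b ∷ zs))) ≡ f (suc s) + σ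
    σ≡ = trans (sum-insertions-head f zs a<x b<x)
               (cong (λ τ → f (suc s) + sum τ) (map-cong (λ l → cong f (desFrom-descent l b<a)) (insertions x zs)))
  ... | no b≮a = begin
    sum (map (f ∘ desFrom a) (insertions x (b ∷ zs))) + desFrom a (b ∷ zs) * f (suc (desFrom a (b ∷ zs)))
      ≡⟨ cong₂ (λ σ s → σ + s * f (suc s)) σ≡ (desFrom-ascent zs a≤b) ⟩
    f (suc s) + σ + s * f (suc s)
      ≡⟨ count-step-ascent s (length zs) σ _ _ (sum-desFrom-insertions f zs b<x zs<x) ⟩
    suc s * f s + suc (length zs) * f (suc s)
      ≡⟨ cong (λ s′ → suc s′ * f s′ + suc (length zs) * f (suc s′)) (desFrom-ascent zs a≤b) ⟨
    suc (desFrom a (b ∷ zs)) * f (desFrom a (b ∷ zs)) + suc (length zs) * f (suc (desFrom a (b ∷ zs))) ∎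
    where
    a≤b : a ≤ b
    a≤b = ≮⇒≥ b≮a
    s σ : ℕ
    s = desFrom b zs
    σ = sum (map (f ∘ desFrom b) (insertions x zs))
    σ≡ : sum (map (f ∘ desFrom a) (insertions x (b ∷ zs))) ≡ f (suc s) + σ
    σ≡ = trans (sum-insertions-head f zs a<x b<x)
               (cong (λ τ → f (suc s) + sum τ) (map-cong (λ l → cong f (desFrom-ascent l a≤b)) (insertions x zs)))

  sum-des-insertions : ∀ (f : ℕ → ℕ) {x} π → All (_< x) π →
    sum (map (f ∘ des) (insertions x π)) + des π * f (suc (des π))
      ≡ suc (des π) * f (des π) + length π * f (suc (des π))
  sum-des-insertions f []       []          = refl
  sum-des-insertions f {x} (a ∷ ys) (a<x ∷ ys<x) = begin
    f (desFrom x (a ∷ ys)) + sum (map (f ∘ des) (map (a ∷_) (insertions x ys))) + s * f (suc s)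
      ≡⟨ cong₂ (λ u τ → f u + sum τ + s * f (suc s)) (desFrom-descent ys a<x) (sym (map-∘ (insertions x ys))) ⟩
    f (suc s) + σ + s * f (suc s)
      ≡⟨ count-step-ascent s (length ys) σ _ _ (sum-desFrom-insertions f ys a<x ys<x) ⟩
    suc s * f s + suc (length ys) * f (suc s) ∎
    where
    s σ : ℕ
    s = desFrom a ys
    σ = sum (map (f ∘ desFrom a) (insertions x ys))

  private
    worpitzky-step-arithmetic : ∀ s d n t σ a b →
      σ + s * b ≡ suc s * (a + b) + d * b → suc d * (a + b) ≡ suc n * a → s + n ≡ t + d → σ ≡ suc t * a
    worpitzky-step-arithmetic s d n t σ a b count absorb sum≡ = +-cancelʳ-≡ (s * b + suc d * a) σ (suc t * a) (begin
      σ + (s * b + suc d * a)             ≡⟨ +-assoc σ (s * b) _ ⟨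
      σ + s * b + suc d * a               ≡⟨ cong (_+ suc d * a) count ⟩
      suc s * (a + b) + d * b + suc d * a ≡⟨ lemma₁ s a b d ⟩
      s * b + suc d * (a + b) + suc s * a ≡⟨ cong (λ u → s * b + u + suc s * a) absorb ⟩
      s * b + suc n * a + suc s * a       ≡⟨ lemma₂ s b n a ⟩
      s * b + suc (suc (s + n)) * a       ≡⟨ cong (λ m → s * b + suc (suc m) * a) sum≡ ⟩
      s * b + suc (suc (t + d)) * a       ≡⟨ lemma₃ s b t d a ⟩
      suc t * a + (s * b + suc d * a)     ∎)
      where
      lemma₁ : ∀ s a b d → suc s * (a + b) + d * b + suc d * a ≡ s * b + suc d * (a + b) + suc s * a
      lemma₁ = solve-∀
      lemma₂ : ∀ s b n a → s * b + suc n * a + suc s * a ≡ s * b + suc (suc (s + n)) * a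
      lemma₂ = solve-∀
      lemma₃ : ∀ s b t d a → s * b + suc (suc (t + d)) * a ≡ suc t * a + (s * b + suc d * a)
      lemma₃ = solve-∀

  sum-ehrhartBasis-insertions : ∀ t d {π} → π ∈ permutations d →
    sum (map (λ l → ehrhartBasis (suc d) (suc (des l)) (suc t)) (insertions d π))
      ≡ suc t * ehrhartBasis d (suc (des π)) (suc t)
  sum-ehrhartBasis-insertions t d {π} π∈ =
    worpitzky-step-arithmetic s d n t _ (n C d) (n C suc d) insertion-count absorption split
    where
    s n : ℕ
    s = des π
    n = t + d ∸ s
    f : ℕ → ℕ
    f s′ = ehrhartBasis (suc d) (suc s′) (suc t)
    s≤t+d : s ≤ t + d
    s≤t+d = ≤-trans (subst (s ≤_) (∈-permutations⇒length π∈) (des≤length π)) (m≤n+m d t)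
    split : s + n ≡ t + d
    split = m+[n∸m]≡n s≤t+d
    f[s]≡ : f s ≡ n C d + n C suc d
    f[s]≡ = trans (cong (λ m → (m ∸ s) C suc d) (+-suc t d))
            (trans (cong (_C suc d) (+-∸-assoc 1 s≤t+d)) (sym (nCk+nC[k+1]≡[n+1]C[k+1] n d)))
    f[s+1]≡ : f (suc s) ≡ n C suc d
    f[s+1]≡ = cong (λ m → (m ∸ suc s) C suc d) (+-suc t d)
    insertion-count : sum (map (f ∘ des) (insertions d π)) + s * (n C suc d)
                      ≡ suc s * (n C d + n C suc d) + d * (n C suc d)
    insertion-count = subst₂ (λ u v → sum (map (f ∘ des) (insertions d π)) + s * v ≡ suc s * u + d * v) f[s]≡ f[s+1]≡
      (subst (λ m → sum (map (f ∘ des) (insertions d π)) + s * f (suc s) ≡ suc s * f s + m * f (suc s))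
             (∈-permutations⇒length {d} π∈) (sum-des-insertions f π (∈-permutations⇒< π∈)))
    absorption : suc d * (n C d + n C suc d) ≡ suc n * (n C d)
    absorption = trans (cong (suc d *_) (nCk+nC[k+1]≡[n+1]C[k+1] n d)) ([k+1]*[n+1]C[k+1]≡[n+1]*nCk n d)
  worpitzky-permutations : ∀ t d →
    sum (map (λ π → ehrhartBasis d (suc (des π)) (suc t)) (permutations d)) ≡ suc t ^ d
  worpitzky-permutations t zero    = refl
  worpitzky-permutations t (suc d) = begin
    sum (map g′ (concatMap (insertions d) (permutations d)))
      ≡⟨ sum-map-concatMap g′ (insertions d) (permutations d) ⟩
    sum (map (λ π → sum (map g′ (insertions d π))) (permutations d))
      ≡⟨ cong sum (map-cong-local (All.tabulate (sum-ehrhartBasis-insertions t d))) ⟩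
    sum (map (λ π → suc t * g π) (permutations d))
      ≡⟨ sum-map-*ˡ (suc t) g (permutations d) ⟩
    suc t * sum (map g (permutations d))
      ≡⟨ cong (suc t *_) (worpitzky-permutations t d) ⟩
    suc t * suc t ^ d ∎
    where
    g g′ : List ℕ → ℕ
    g  π = ehrhartBasis d (suc (des π)) (suc t)
    g′ l = ehrhartBasis (suc d) (suc (des l)) (suc t)

module RangeSums where

  open import Defs using (sumUpToℤ)
  open import Data.Nat as ℕ using (ℕ; zero; suc; _≤_; _<_; z≤n)
  open import Data.Nat.Properties using (≤-refl; m≤n⇒m≤1+n; ≤-pred; ≤∧≢⇒<; <⇒≱)
  open import Data.Integer using (ℤ; 0ℤ; 1ℤ; _+_; _*_; -_)
  open import Data.Integer.Properties using (+-identityˡ; +-identityʳ; *-identityˡ; *-zeroˡ; +-assoc; neg-distrib-+; *-distribˡ-+; *-distribʳ-+)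
  open import Data.Integer.Tactic.RingSolver using (solve-∀)
  open import Data.Empty using (⊥-elim)
  open import Function using (_∘_)
  open import Relation.Nullary using (yes; no)
  open import Relation.Binary.PropositionalEquality

  sumUpToℤ-cong : ∀ K {f g : ℕ → ℤ} → (∀ j → f j ≡ g j) → sumUpToℤ K f ≡ sumUpToℤ K g
  sumUpToℤ-cong zero    f≗g = f≗g 0
  sumUpToℤ-cong (suc K) f≗g = cong₂ _+_ (sumUpToℤ-cong K f≗g) (f≗g (suc K))

  sumUpToℤ-cong≤ : ∀ K {f g : ℕ → ℤ} → (∀ j → j ≤ K → f j ≡ g j) → sumUpToℤ K f ≡ sumUpToℤ K g
  sumUpToℤ-cong≤ zero    f≗g = f≗g 0 z≤n
  sumUpToℤ-cong≤ (suc K) f≗g =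
    cong₂ _+_ (sumUpToℤ-cong≤ K (λ j j≤K → f≗g j (m≤n⇒m≤1+n j≤K))) (f≗g (suc K) ≤-refl)

  sumUpToℤ-≡0 : ∀ K {f : ℕ → ℤ} → (∀ j → j ≤ K → f j ≡ 0ℤ) → sumUpToℤ K f ≡ 0ℤ
  sumUpToℤ-≡0 K {f} f≡0 = trans (sumUpToℤ-cong≤ K {g = λ _ → 0ℤ} f≡0) (zeros K)
    where
    zeros : ∀ K → sumUpToℤ K (λ _ → 0ℤ) ≡ 0ℤ
    zeros zero    = refl
    zeros (suc K) = cong (_+ 0ℤ) (zeros K)

  sumUpToℤ-+ : ∀ K (f g : ℕ → ℤ) → sumUpToℤ K (λ j → f j + g j) ≡ sumUpToℤ K f + sumUpToℤ K g
  sumUpToℤ-+ zero    f g = refl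
  sumUpToℤ-+ (suc K) f g =
    trans (cong (_+ (f (suc K) + g (suc K))) (sumUpToℤ-+ K f g)) (lemma (sumUpToℤ K f) (sumUpToℤ K g) _ _)
    where
    lemma : ∀ a b c d → a + b + (c + d) ≡ a + c + (b + d)
    lemma = solve-∀

  sumUpToℤ-neg : ∀ K (f : ℕ → ℤ) → sumUpToℤ K (λ j → - f j) ≡ - sumUpToℤ K f
  sumUpToℤ-neg zero    f = refl
  sumUpToℤ-neg (suc K) f =
    trans (cong (_+ - f (suc K)) (sumUpToℤ-neg K f)) (sym (neg-distrib-+ (sumUpToℤ K f) (f (suc K))))

  sumUpToℤ-*ˡ : ∀ K c (f : ℕ → ℤ) → sumUpToℤ K (λ j → c * f j) ≡ c * sumUpToℤ K f
  sumUpToℤ-*ˡ zero    c f = refl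
  sumUpToℤ-*ˡ (suc K) c f =
    trans (cong (_+ c * f (suc K)) (sumUpToℤ-*ˡ K c f)) (sym (*-distribˡ-+ c (sumUpToℤ K f) (f (suc K))))

  sumUpToℤ-*ʳ : ∀ K (f : ℕ → ℤ) c → sumUpToℤ K (λ j → f j * c) ≡ sumUpToℤ K f * c
  sumUpToℤ-*ʳ zero    f c = refl
  sumUpToℤ-*ʳ (suc K) f c =
    trans (cong (_+ f (suc K) * c) (sumUpToℤ-*ʳ K f c)) (sym (*-distribʳ-+ c (sumUpToℤ K f) (f (suc K))))

  sumUpToℤ-suc : ∀ K (f : ℕ → ℤ) → sumUpToℤ (suc K) f ≡ f 0 + sumUpToℤ K (λ j → f (suc j))
  sumUpToℤ-suc zero    f = refl
  sumUpToℤ-suc (suc K) f = trans (cong (_+ f (suc (suc K))) (sumUpToℤ-suc K f)) (+-assoc (f 0) _ _)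

  sumUpToℤ-swap : ∀ K L (g : ℕ → ℕ → ℤ) →
    sumUpToℤ K (λ k → sumUpToℤ L (λ j → g k j)) ≡ sumUpToℤ L (λ j → sumUpToℤ K (λ k → g k j))
  sumUpToℤ-swap zero    L g = refl
  sumUpToℤ-swap (suc K) L g =
    trans (cong (_+ sumUpToℤ L (g (suc K))) (sumUpToℤ-swap K L g))
          (sym (sumUpToℤ-+ L (λ j → sumUpToℤ K (λ k → g k j)) (g (suc K))))

  sum1Toℤ : ℕ → (ℕ → ℤ) → ℤ
  sum1Toℤ zero    f = 0ℤ
  sum1Toℤ (suc K) f = sum1Toℤ K f + f (suc K)

  sumUpToℤ-split : ∀ K (f : ℕ → ℤ) → sumUpToℤ (suc K) f ≡ f 0 + sum1Toℤ K f + f (suc K)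
  sumUpToℤ-split K f = cong (_+ f (suc K)) (head K)
    where
    head : ∀ K → sumUpToℤ K f ≡ f 0 + sum1Toℤ K f
    head zero    = sym (+-identityʳ (f 0))
    head (suc K) = trans (cong (_+ f (suc K)) (head K)) (+-assoc (f 0) _ _)

  δ : ℕ → ℕ → ℤ
  δ zero    zero    = 1ℤ
  δ zero    (suc k) = 0ℤ
  δ (suc c) zero    = 0ℤ
  δ (suc c) (suc k) = δ c k

  δ-refl : ∀ c → δ c c ≡ 1ℤ
  δ-refl zero    = refl
  δ-refl (suc c) = δ-refl c

  δ-≢ : ∀ {c k} → c ≢ k → δ c k ≡ 0ℤ
  δ-≢ {zero}  {zero}  c≢k = ⊥-elim (c≢k refl)
  δ-≢ {zero}  {suc k} c≢k = refl
  δ-≢ {suc c} {zero}  c≢k = refl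
  δ-≢ {suc c} {suc k} c≢k = δ-≢ (c≢k ∘ cong suc)

  sumUpToℤ-δ-beyond : ∀ K c (f : ℕ → ℤ) → K < c → sumUpToℤ K (λ k → δ c k * f k) ≡ 0ℤ
  sumUpToℤ-δ-beyond K c f K<c =
    sumUpToℤ-≡0 K (λ k k≤K → trans (cong (_* f k) (δ-≢ {c} {k} (λ { refl → <⇒≱ K<c k≤K }))) (*-zeroˡ (f k)))

  sumUpToℤ-δ : ∀ K c (f : ℕ → ℤ) → c ≤ K → sumUpToℤ K (λ k → δ c k * f k) ≡ f c
  sumUpToℤ-δ zero    zero    f z≤n = *-identityˡ (f 0)
  sumUpToℤ-δ (suc K) c       f c≤1+K with c ℕ.≟ suc K
  ... | yes refl = begin
    sumUpToℤ K (λ k → δ (suc K) k * f k) + δ (suc K) (suc K) * f (suc K)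
      ≡⟨ cong₂ _+_ (sumUpToℤ-δ-beyond K (suc K) f ≤-refl) (cong (_* f (suc K)) (δ-refl K)) ⟩
    0ℤ + 1ℤ * f (suc K)
      ≡⟨ trans (+-identityˡ _) (*-identityˡ (f (suc K))) ⟩
    f (suc K) ∎
    where open ≡-Reasoning
  ... | no c≢1+K = begin
    sumUpToℤ K (λ k → δ c k * f k) + δ c (suc K) * f (suc K)
      ≡⟨ cong₂ _+_ (sumUpToℤ-δ K c f (≤-pred (≤∧≢⇒< c≤1+K c≢1+K))) (cong (_* f (suc K)) (δ-≢ c≢1+K)) ⟩
    f c + 0ℤ * f (suc K)
      ≡⟨ trans (cong (f c +_) (*-zeroˡ (f (suc K)))) (+-identityʳ (f c)) ⟩
    f c ∎
    where open ≡-Reasoning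

module EulerianNumbers where

  open import Defs using (des; sumUpToℤ; HasCount; IsEulerianCoeff)
  open Counting
  open Permutations
  open Binomials using (ehrhartBasis)
  open Worpitzky using (↭-upTo⇒suc-des≤; worpitzky-permutations)
  open RangeSums
  open import Data.Nat using (ℕ; suc; _^_; _≤_; _<_; _≟_)
  open import Data.Nat.Properties using (<⇒≱)
  open import Data.Nat.ListAction using (sum)
  open import Data.Integer using (+_; _+_; _*_)
  open import Data.Integer.Properties using (*-distribʳ-+)
  open import Data.List using (List; []; _∷_; map; filter; length; upTo)
  open import Data.List.Properties using (filter-accept; filter-reject)
  open import Data.List.Relation.Unary.All as All using (All; []; _∷_)
  open import Data.List.Relation.Unary.Unique.Propositional.Properties using (filter⁺)
  open import Data.List.Membership.Propositional.Properties using (∈-filter⁺; ∈-filter⁻)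
  open import Data.List.Relation.Binary.Permutation.Propositional using (_↭_)
  open import Data.Product using (_×_; _,_)
  open import Function using (_∘_)
  open import Relation.Nullary using (Dec; yes; no)
  open import Relation.Binary.PropositionalEquality
  open ≡-Reasoning

  suc-des≟ : ∀ k (π : List ℕ) → Dec (suc (des π) ≡ k)
  suc-des≟ k π = suc (des π) ≟ k

  eulerianCount : ℕ → List (List ℕ) → ℕ
  eulerianCount k = length ∘ filter (suc-des≟ k)

  eulerianCount-HasCount : ∀ d k →
    HasCount (λ π → (π ↭ upTo d) × suc (des π) ≡ k) (eulerianCount k (permutations d))
  eulerianCount-HasCount d k =
    filter (suc-des≟ k) (permutations d) , filter⁺ (suc-des≟ k) (permutations-unique d) ,
    All.tabulate (λ π∈ → let π∈ps , Pπ = ∈-filter⁻ (suc-des≟ k) π∈ in ∈-permutations⇒↭ π∈ps , Pπ) ,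
    (λ π (π↭ , Pπ) → ∈-filter⁺ (suc-des≟ k) (↭⇒∈-permutations π↭) Pπ) , refl

  eulerianCoeff≡eulerianCount : ∀ {d k n} → IsEulerianCoeff d k n → n ≡ eulerianCount k (permutations d)
  eulerianCoeff≡eulerianCount {d} {k} count = HasCount-unique count (eulerianCount-HasCount d k)

  eulerianCoeff-0 : ∀ {d n} → IsEulerianCoeff d 0 n → n ≡ 0
  eulerianCoeff-0 = HasCount-empty (λ _ ())

  eulerianCoeff-beyond : ∀ {d k n} → suc d < k → IsEulerianCoeff (suc d) k n → n ≡ 0
  eulerianCoeff-beyond d<k = HasCount-empty (λ { π (π↭ , refl) → <⇒≱ d<k (↭-upTo⇒suc-des≤ π↭) })

  eulerianCount-∷ : ∀ k π ps → + eulerianCount k (π ∷ ps) ≡ δ (suc (des π)) k + + eulerianCount k ps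
  eulerianCount-∷ k π ps with suc (des π) ≟ k
  ... | yes c≡k = trans (cong (λ l → + length l) (filter-accept (suc-des≟ k) {π} {ps} c≡k))
                        (cong (_+ + eulerianCount k ps) (sym (trans (cong (δ (suc (des π))) (sym c≡k)) (δ-refl (suc (des π))))))
  ... | no  c≢k = trans (cong (λ l → + length l) (filter-reject (suc-des≟ k) {π} {ps} c≢k))
                        (cong (_+ + eulerianCount k ps) (sym (δ-≢ {suc (des π)} {k} c≢k)))

  sumUpToℤ-eulerianCount : ∀ K (g : ℕ → ℕ) ps → All (λ π → suc (des π) ≤ K) ps →
    sumUpToℤ K (λ k → + eulerianCount k ps * + g k) ≡ + sum (map (g ∘ suc ∘ des) ps)
  sumUpToℤ-eulerianCount K g []       []               = sumUpToℤ-≡0 K (λ _ _ → refl)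
  sumUpToℤ-eulerianCount K g (π ∷ ps) (π-bound ∷ bounds) = begin
    sumUpToℤ K (λ k → + eulerianCount k (π ∷ ps) * + g k)
      ≡⟨ sumUpToℤ-cong K (λ k → trans (cong (_* + g k) (eulerianCount-∷ k π ps)) (*-distribʳ-+ (+ g k) (δ (suc (des π)) k) _)) ⟩
    sumUpToℤ K (λ k → δ (suc (des π)) k * + g k + + eulerianCount k ps * + g k)
      ≡⟨ sumUpToℤ-+ K _ _ ⟩
    sumUpToℤ K (λ k → δ (suc (des π)) k * + g k) + sumUpToℤ K (λ k → + eulerianCount k ps * + g k)
      ≡⟨ cong₂ _+_ (sumUpToℤ-δ K (suc (des π)) (λ k → + g k) π-bound) (sumUpToℤ-eulerianCount K g ps bounds) ⟩
    + g (suc (des π)) + + sum (map (g ∘ suc ∘ des) ps) ∎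

  worpitzky : ∀ d t (a : ℕ → ℕ) → (∀ k → IsEulerianCoeff (suc d) k (a k)) →
    sumUpToℤ (suc d) (λ k → + a k * + ehrhartBasis (suc d) k (suc t)) ≡ + (suc t ^ suc d)
  worpitzky d t a a-eulerian = begin
    sumUpToℤ (suc d) (λ k → + a k * + g k)
      ≡⟨ sumUpToℤ-cong (suc d) (λ k → cong (λ n → + n * + g k) (eulerianCoeff≡eulerianCount (a-eulerian k))) ⟩
    sumUpToℤ (suc d) (λ k → + eulerianCount k (permutations (suc d)) * + g k)
      ≡⟨ sumUpToℤ-eulerianCount (suc d) g (permutations (suc d)) (All.tabulate (↭-upTo⇒suc-des≤ ∘ ∈-permutations⇒↭)) ⟩
    + sum (map (g ∘ suc ∘ des) (permutations (suc d)))
      ≡⟨ cong +_ (worpitzky-permutations t (suc d)) ⟩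
    + (suc t ^ suc d) ∎
    where
    g : ℕ → ℕ
    g k = ehrhartBasis (suc d) k (suc t)

module FiniteDifferences where

  open import Defs using (sumUpToℤ; signℤ)
  open RangeSums
  open Binomials using (ehrhartBasis)
  open import Data.Nat as ℕ using (ℕ; zero; suc; _∸_; _≤_; _<_; s≤s)
  open import Data.Nat.Properties using (≤-trans; ≤-<-connex; m∸n≤m; n≤1+n; +-suc)
  open import Data.Nat.Combinatorics using (_C_; nCk+nC[k+1]≡[n+1]C[k+1]; nCn≡1; k>n⇒nCk≡0)
  open import Data.Integer using (ℤ; +_; 0ℤ; 1ℤ; _+_; _-_; _*_; -_)
  open import Data.Integer.Properties using (+-identityʳ; *-identityˡ; *-zeroˡ; *-zeroʳ; *-comm; pos-+)
  open import Data.Integer.Tactic.RingSolver using (solve-∀)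
  open import Data.Sum using (inj₁; inj₂)
  open import Function using (_∘_)
  open import Relation.Binary.PropositionalEquality
  open ≡-Reasoning

  -- Reading F as the power series ∑ F n xⁿ, Δ is multiplication by 1 − x and shift
  -- (below) multiplication by x.
  Δ : (ℕ → ℤ) → ℕ → ℤ
  Δ F zero    = F zero
  Δ F (suc n) = F (suc n) - F n

  Δ^ : ℕ → (ℕ → ℤ) → ℕ → ℤ
  Δ^ zero    F = F
  Δ^ (suc e) F = Δ (Δ^ e F)

  Δ-cong : ∀ {F G} → (∀ n → F n ≡ G n) → ∀ n → Δ F n ≡ Δ G n
  Δ-cong F≗G zero    = F≗G 0
  Δ-cong F≗G (suc n) = cong₂ _-_ (F≗G (suc n)) (F≗G n)

  Δ^-cong : ∀ e {F G} → (∀ n → F n ≡ G n) → ∀ n → Δ^ e F n ≡ Δ^ e G n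
  Δ^-cong zero    F≗G = F≗G
  Δ^-cong (suc e) F≗G = Δ-cong (Δ^-cong e F≗G)

  Δ^-suc : ∀ e F n → Δ^ (suc e) F n ≡ Δ^ e (Δ F) n
  Δ^-suc zero    F n = refl
  Δ^-suc (suc e) F n = Δ-cong (Δ^-suc e F) n

  Δ-injective : ∀ {F G} → (∀ n → Δ F n ≡ Δ G n) → ∀ n → F n ≡ G n
  Δ-injective ΔF≗ΔG zero    = ΔF≗ΔG 0
  Δ-injective {F} {G} ΔF≗ΔG (suc n) = begin
    F (suc n)                 ≡⟨ lemma (F (suc n)) (F n) ⟩
    F (suc n) - F n + F n     ≡⟨ cong₂ _+_ (ΔF≗ΔG (suc n)) (Δ-injective ΔF≗ΔG n) ⟩
    G (suc n) - G n + G n     ≡⟨ lemma (G (suc n)) (G n) ⟨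
    G (suc n)                 ∎
    where
    lemma : ∀ a b → a ≡ a - b + b
    lemma = solve-∀

  Δ^-injective : ∀ e {F G} → (∀ n → Δ^ e F n ≡ Δ^ e G n) → ∀ n → F n ≡ G n
  Δ^-injective zero    F≗G = F≗G
  Δ^-injective (suc e) F≗G = Δ^-injective e (Δ-injective F≗G)

  alternatingSum≡Δ^ : ∀ e F K → sumUpToℤ K (λ j → signℤ j * + (e C j) * F (K ∸ j)) ≡ Δ^ e F K
  alternatingSum≡Δ^ zero    F zero    = *-identityˡ (F 0)
  alternatingSum≡Δ^ zero    F (suc K) = begin
    sumUpToℤ (suc K) (λ j → signℤ j * + (0 C j) * F (suc K ∸ j))
      ≡⟨ sumUpToℤ-suc K _ ⟩
    1ℤ * 1ℤ * F (suc K) + sumUpToℤ K (λ j → signℤ (suc j) * 0ℤ * F (K ∸ j))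
      ≡⟨ cong₂ _+_ (*-identityˡ (F (suc K))) (sumUpToℤ-≡0 K (λ j _ → vanish j)) ⟩
    F (suc K) + 0ℤ
      ≡⟨ +-identityʳ (F (suc K)) ⟩
    F (suc K) ∎
    where
    vanish : ∀ j → signℤ (suc j) * 0ℤ * F (K ∸ j) ≡ 0ℤ
    vanish j = trans (cong (_* F (K ∸ j)) (*-zeroʳ (signℤ (suc j)))) (*-zeroˡ (F (K ∸ j)))
  alternatingSum≡Δ^ (suc e) F zero    = alternatingSum≡Δ^ e F zero
  alternatingSum≡Δ^ (suc e) F (suc K) = begin
    sumUpToℤ (suc K) (λ j → signℤ j * + (suc e C j) * F (suc K ∸ j))
      ≡⟨ sumUpToℤ-suc K _ ⟩
    χ 0 + sumUpToℤ K (λ j → signℤ (suc j) * + (suc e C suc j) * F (K ∸ j))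
      ≡⟨ cong (_+_ (χ 0)) (sumUpToℤ-cong K pascal) ⟩
    χ 0 + sumUpToℤ K (λ j → χ (suc j) + - ψ j)
      ≡⟨ cong (_+_ (χ 0)) (trans (sumUpToℤ-+ K _ _) (cong (_+_ (sumUpToℤ K (χ ∘ suc))) (sumUpToℤ-neg K ψ))) ⟩
    χ 0 + (sumUpToℤ K (χ ∘ suc) - sumUpToℤ K ψ)
      ≡⟨ lemma (χ 0) _ _ ⟩
    χ 0 + sumUpToℤ K (χ ∘ suc) - sumUpToℤ K ψ
      ≡⟨ cong (_- sumUpToℤ K ψ) (sumUpToℤ-suc K χ) ⟨
    sumUpToℤ (suc K) χ - sumUpToℤ K ψ
      ≡⟨ cong₂ _-_ (alternatingSum≡Δ^ e F (suc K)) (alternatingSum≡Δ^ e F K) ⟩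
    Δ^ e F (suc K) - Δ^ e F K ∎
    where
    χ ψ : ℕ → ℤ
    χ j = signℤ j * + (e C j) * F (suc K ∸ j)
    ψ j = signℤ j * + (e C j) * F (K ∸ j)
    lemma : ∀ a b c → a + (b - c) ≡ a + b - c
    lemma = solve-∀
    split : ∀ s b₁ b₂ x → (- s) * (b₁ + b₂) * x ≡ (- s) * b₂ * x + - (s * b₁ * x)
    split = solve-∀
    pascal : ∀ j → signℤ (suc j) * + (suc e C suc j) * F (K ∸ j) ≡ χ (suc j) + - ψ j
    pascal j = trans (cong (λ c → signℤ (suc j) * c * F (K ∸ j))
                           (trans (cong +_ (sym (nCk+nC[k+1]≡[n+1]C[k+1] e j))) (pos-+ (e C j) (e C suc j))))
                     (split (signℤ j) (+ (e C j)) (+ (e C suc j)) (F (K ∸ j)))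

  shift : (ℕ → ℤ) → ℕ → ℤ
  shift G zero    = 0ℤ
  shift G (suc n) = G n

  shift^ : ℕ → (ℕ → ℤ) → ℕ → ℤ
  shift^ zero    G = G
  shift^ (suc k) G = shift (shift^ k G)

  shift^-cong : ∀ k {F G} → (∀ n → F n ≡ G n) → ∀ n → shift^ k F n ≡ shift^ k G n
  shift^-cong zero    F≗G n       = F≗G n
  shift^-cong (suc k) F≗G zero    = refl
  shift^-cong (suc k) F≗G (suc n) = shift^-cong k F≗G n

  Δ-shift : ∀ G n → Δ (shift G) n ≡ shift (Δ G) n
  Δ-shift G zero          = refl
  Δ-shift G (suc zero)    = +-identityʳ (G 0)
  Δ-shift G (suc (suc n)) = refl

  Δ-shift^ : ∀ k G n → Δ (shift^ k G) n ≡ shift^ k (Δ G) n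
  Δ-shift^ zero    G n       = refl
  Δ-shift^ (suc k) G zero    = refl
  Δ-shift^ (suc k) G (suc n) = trans (Δ-shift (shift^ k G) (suc n)) (Δ-shift^ k G n)

  Δ^-shift^ : ∀ e k G n → Δ^ e (shift^ k G) n ≡ shift^ k (Δ^ e G) n
  Δ^-shift^ zero    k G n = refl
  Δ^-shift^ (suc e) k G n = trans (Δ-cong (Δ^-shift^ e k G) n) (Δ-shift^ k (Δ^ e G) n)

  shift^-δ : ∀ k K → shift^ k (δ 0) K ≡ δ K k
  shift^-δ zero    zero    = refl
  shift^-δ zero    (suc K) = refl
  shift^-δ (suc k) zero    = refl
  shift^-δ (suc k) (suc K) = shift^-δ k K

  binomialSeries : ℕ → ℕ → ℤ
  binomialSeries e n = + ((n ℕ.+ e) C e)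

  Δ-binomialSeries : ∀ e n → Δ (binomialSeries (suc e)) n ≡ binomialSeries e n
  Δ-binomialSeries e zero    = cong +_ (trans (nCn≡1 (suc e)) (sym (nCn≡1 e)))
  Δ-binomialSeries e (suc m) = begin
    + (suc (m ℕ.+ suc e) C suc e) - + B ≡⟨ cong (λ n → + n - + B) (nCk+nC[k+1]≡[n+1]C[k+1] (m ℕ.+ suc e) e) ⟨
    + (A ℕ.+ B) - + B ≡⟨ cong (_- + B) (pos-+ A B) ⟩
    + A + + B - + B   ≡⟨ lemma (+ A) (+ B) ⟩
    + A               ≡⟨ cong (λ n → + (n C e)) (+-suc m e) ⟩
    binomialSeries e (suc m) ∎
    where
    A B : ℕ
    A = (m ℕ.+ suc e) C e
    B = (m ℕ.+ suc e) C suc e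
    lemma : ∀ a b → a + b - b ≡ a
    lemma = solve-∀

  Δ^-binomialSeries : ∀ e n → Δ^ (suc e) (binomialSeries e) n ≡ δ 0 n
  Δ^-binomialSeries zero    zero    = refl
  Δ^-binomialSeries zero    (suc n) = refl
  Δ^-binomialSeries (suc e) n =
    trans (Δ^-suc (suc e) (binomialSeries (suc e)) n)
          (trans (Δ^-cong (suc e) (Δ-binomialSeries e) n) (Δ^-binomialSeries e n))

  shift^-binomialSeries : ∀ d k t → k ≤ d → shift^ k (binomialSeries d) t ≡ + ehrhartBasis d k t
  shift^-binomialSeries d       zero    t       _       = refl
  shift^-binomialSeries (suc d) (suc k) zero    (s≤s _) = sym (cong +_ (k>n⇒nCk≡0 (s≤s (m∸n≤m d k))))
  shift^-binomialSeries d       (suc k) (suc t) k<d     = shift^-binomialSeries d k t (≤-trans (n≤1+n k) k<d)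

  Δ-linear : ∀ K (h : ℕ → ℤ) (B : ℕ → ℕ → ℤ) n →
    Δ (λ t → sumUpToℤ K (λ k → h k * B k t)) n ≡ sumUpToℤ K (λ k → h k * Δ (B k) n)
  Δ-linear K h B zero    = refl
  Δ-linear K h B (suc n) = sym (begin
    sumUpToℤ K (λ k → h k * (B k (suc n) - B k n))
      ≡⟨ sumUpToℤ-cong K (λ k → lemma (h k) (B k (suc n)) (B k n)) ⟩
    sumUpToℤ K (λ k → h k * B k (suc n) + - (h k * B k n))
      ≡⟨ sumUpToℤ-+ K _ _ ⟩
    sumUpToℤ K (λ k → h k * B k (suc n)) + sumUpToℤ K (λ k → - (h k * B k n))
      ≡⟨ cong (_+_ (sumUpToℤ K (λ k → h k * B k (suc n)))) (sumUpToℤ-neg K _) ⟩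
    sumUpToℤ K (λ k → h k * B k (suc n)) - sumUpToℤ K (λ k → h k * B k n) ∎)
    where
    lemma : ∀ a x y → a * (x - y) ≡ a * x + - (a * y)
    lemma = solve-∀

  Δ^-linear : ∀ e K (h : ℕ → ℤ) (B : ℕ → ℕ → ℤ) n →
    Δ^ e (λ t → sumUpToℤ K (λ k → h k * B k t)) n ≡ sumUpToℤ K (λ k → h k * Δ^ e (B k) n)
  Δ^-linear zero    K h B n = refl
  Δ^-linear (suc e) K h B n = trans (Δ-cong (Δ^-linear e K h B) n) (Δ-linear K h (λ k → Δ^ e (B k)) n)

  -- In series terms F = h / (1 − x)^(d+1), and (1 − x)^−(d+1) = ∑ C(n + d, d) xⁿ.
  Δ^-expansion : ∀ d F → (∀ k → d < k → Δ^ (suc d) F k ≡ 0ℤ) →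
                 ∀ t → F t ≡ sumUpToℤ d (λ k → Δ^ (suc d) F k * + ehrhartBasis d k t)
  Δ^-expansion d F vanish t =
    trans (Δ^-injective (suc d) agree t)
          (sumUpToℤ-cong≤ d (λ k k≤d → cong (h k *_) (shift^-binomialSeries d k t k≤d)))
    where
    h : ℕ → ℤ
    h = Δ^ (suc d) F
    G : ℕ → ℤ
    G t = sumUpToℤ d (λ k → h k * shift^ k (binomialSeries d) t)
    Δ^G : ∀ K → Δ^ (suc d) G K ≡ sumUpToℤ d (λ k → δ K k * h k)
    Δ^G K = trans (Δ^-linear (suc d) d h _ K)
                  (sumUpToℤ-cong d (λ k → trans (cong (h k *_) (Δ^-basis k)) (*-comm (h k) (δ K k))))
      where
      Δ^-basis : ∀ k → Δ^ (suc d) (shift^ k (binomialSeries d)) K ≡ δ K k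
      Δ^-basis k = trans (Δ^-shift^ (suc d) k _ K)
                         (trans (shift^-cong k (Δ^-binomialSeries d) K) (shift^-δ k K))
    agree : ∀ K → h K ≡ Δ^ (suc d) G K
    agree K with ≤-<-connex K d
    ... | inj₁ K≤d = sym (trans (Δ^G K) (sumUpToℤ-δ d K h K≤d))
    ... | inj₂ d<K = trans (vanish K d<K) (sym (trans (Δ^G K) (sumUpToℤ-δ-beyond d K h d<K)))

module RisingFactorials where

  open import Defs using (sumUpToℤ)
  open RangeSums
  open Binomials using (ehrhartBasis; [k+1]*[n+1]C[k+1]≡[n+1]*nCk)
  open import Data.Nat as ℕ using (ℕ; zero; suc; _∸_; _≤_; _<_; s≤s; _!)
  open import Data.Nat.Properties as ℕ using (≤-trans; m≤n+m; n<1+n; m≤n⇒m≤1+n; ≤-pred; ≤∧≢⇒<)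
  open import Data.Nat.Combinatorics using (_C_)
  open import Data.Nat.Tactic.RingSolver as ℕ-Solver using ()
  open import Data.Integer using (ℤ; +_; 0ℤ; 1ℤ; _+_; _-_; _*_; -_; _^_)
  open import Data.Integer.Properties
    using (+-identityʳ; *-identityʳ; *-zeroˡ; *-zeroʳ; +-assoc; +-inverseˡ; pos-+; pos-*; ⊖-≥; m-n≡m⊖n)
  open import Data.Integer.Tactic.RingSolver using (solve-∀)
  open import Relation.Nullary using (yes; no)
  open import Relation.Binary.PropositionalEquality
  open ≡-Reasoning

  rising : ℤ → ℕ → ℤ
  rising r zero    = 1ℤ
  rising r (suc e) = (r + + suc e) * rising r e

  risingCoeff : ℤ → ℕ → ℕ → ℤ
  risingCoeff r zero    zero    = 1ℤ
  risingCoeff r zero    (suc j) = 0ℤ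
  risingCoeff r (suc e) zero    = (r + + suc e) * risingCoeff r e zero
  risingCoeff r (suc e) (suc j) = (r + + suc e) * risingCoeff r e (suc j) + risingCoeff r e j

  risingCoeff-beyond : ∀ r e j → e < j → risingCoeff r e j ≡ 0ℤ
  risingCoeff-beyond r zero    (suc j) _         = refl
  risingCoeff-beyond r (suc e) (suc j) (s≤s e<j) = begin
    (r + + suc e) * risingCoeff r e (suc j) + risingCoeff r e j
      ≡⟨ cong₂ (λ a b → (r + + suc e) * a + b) (risingCoeff-beyond r e (suc j) (m≤n⇒m≤1+n e<j))
                                                (risingCoeff-beyond r e j e<j) ⟩
    (r + + suc e) * 0ℤ + 0ℤ
      ≡⟨ cong (_+ 0ℤ) (*-zeroʳ (r + + suc e)) ⟩
    0ℤ ∎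

  risingCoeff-top : ∀ r e → risingCoeff r e e ≡ 1ℤ
  risingCoeff-top r zero    = refl
  risingCoeff-top r (suc e) = begin
    (r + + suc e) * risingCoeff r e (suc e) + risingCoeff r e e
      ≡⟨ cong₂ (λ a b → (r + + suc e) * a + b) (risingCoeff-beyond r e (suc e) (n<1+n e)) (risingCoeff-top r e) ⟩
    (r + + suc e) * 0ℤ + 1ℤ
      ≡⟨ cong (_+ 1ℤ) (*-zeroʳ (r + + suc e)) ⟩
    1ℤ ∎

  risingCoeff-0 : ∀ r e → risingCoeff r e 0 ≡ rising r e
  risingCoeff-0 r zero    = refl
  risingCoeff-0 r (suc e) = cong ((r + + suc e) *_) (risingCoeff-0 r e)

  sumUpToℤ-risingCoeff : ∀ r e x → sumUpToℤ e (λ j → risingCoeff r e j * x ^ j) ≡ rising (x + r) e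
  sumUpToℤ-risingCoeff r zero    x = refl
  sumUpToℤ-risingCoeff r (suc e) x = begin
    sumUpToℤ (suc e) (λ j → risingCoeff r (suc e) j * x ^ j)
      ≡⟨ sumUpToℤ-suc e _ ⟩
    c * p₀ * 1ℤ + sumUpToℤ e (λ j → (c * risingCoeff r e (suc j) + risingCoeff r e j) * (x * x ^ j))
      ≡⟨ cong (_+_ (c * p₀ * 1ℤ)) (sumUpToℤ-cong e (λ j → distribute c (risingCoeff r e (suc j)) (risingCoeff r e j) x (x ^ j))) ⟩
    c * p₀ * 1ℤ + sumUpToℤ e (λ j → c * (risingCoeff r e (suc j) * (x * x ^ j)) + x * (risingCoeff r e j * x ^ j))
      ≡⟨ cong (_+_ (c * p₀ * 1ℤ)) (trans (sumUpToℤ-+ e _ _) (cong₂ _+_ (sumUpToℤ-*ˡ e c _) (sumUpToℤ-*ˡ e x _))) ⟩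
    c * p₀ * 1ℤ + (c * σ₁ + x * σ)
      ≡⟨ regroup c p₀ σ₁ x σ ⟩
    c * (p₀ * 1ℤ + σ₁) + x * σ
      ≡⟨ cong (λ y → c * y + x * σ) σ≡ ⟨
    c * σ + x * σ
      ≡⟨ factor c x σ ⟩
    (x + c) * σ
      ≡⟨ cong₂ _*_ (sym (+-assoc x r (+ suc e))) (sumUpToℤ-risingCoeff r e x) ⟩
    (x + r + + suc e) * rising (x + r) e ∎
    where
    c p₀ σ σ₁ : ℤ
    c = r + + suc e
    p₀ = risingCoeff r e 0
    σ  = sumUpToℤ e (λ j → risingCoeff r e j * x ^ j)
    σ₁ = sumUpToℤ e (λ j → risingCoeff r e (suc j) * (x * x ^ j))
    σ≡ : σ ≡ p₀ * 1ℤ + σ₁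
    σ≡ = begin
      σ                                                      ≡⟨ +-identityʳ σ ⟨
      σ + 0ℤ                                                 ≡⟨ cong (_+_ σ) top-vanishes ⟨
      sumUpToℤ (suc e) (λ j → risingCoeff r e j * x ^ j)     ≡⟨ sumUpToℤ-suc e _ ⟩
      p₀ * 1ℤ + σ₁                                           ∎
      where
      top-vanishes : risingCoeff r e (suc e) * x ^ suc e ≡ 0ℤ
      top-vanishes = trans (cong (_* x ^ suc e) (risingCoeff-beyond r e (suc e) (n<1+n e))) (*-zeroˡ (x ^ suc e))
    distribute : ∀ c p q x w → (c * p + q) * (x * w) ≡ c * (p * (x * w)) + x * (q * w)
    distribute = solve-∀
    regroup : ∀ c p a x s → c * p * 1ℤ + (c * a + x * s) ≡ c * (p * 1ℤ + a) + x * s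
    regroup = solve-∀
    factor : ∀ c x s → c * s + x * s ≡ (x + c) * s
    factor = solve-∀

  rising-0 : ∀ e → rising 0ℤ e ≡ + (e !)
  rising-0 zero    = refl
  rising-0 (suc e) = trans (cong (+ suc e *_) (rising-0 e)) (sym (pos-* (suc e) (e !)))

  rising-neg : ∀ {k} e → 1 ≤ k → k ≤ e → rising (- + k) e ≡ 0ℤ
  rising-neg zero    (s≤s _) ()
  rising-neg {k} (suc e) 1≤k k≤1+e with k ℕ.≟ suc e
  ... | yes refl = trans (cong (_* rising (- + k) e) (+-inverseˡ (+ k))) (*-zeroˡ (rising (- + k) e))
  ... | no  k≢1+e = trans (cong ((- + k + + suc e) *_) (rising-neg e 1≤k (≤-pred (≤∧≢⇒< k≤1+e k≢1+e))))
                          (*-zeroʳ (- + k + + suc e))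

  factorial*C≡rising : ∀ e n → + (e ! ℕ.* (n C e)) ≡ rising (+ n - + e) e
  factorial*C≡rising zero    n       = refl
  factorial*C≡rising (suc e) zero    = begin
    + (suc e ! ℕ.* 0)                       ≡⟨ cong +_ (ℕ.*-zeroʳ (suc e !)) ⟩
    0ℤ                                      ≡⟨ *-zeroˡ (rising (- + suc e) e) ⟨
    0ℤ * rising (- + suc e) e               ≡⟨ cong (_* rising (- + suc e) e) (+-inverseˡ (+ suc e)) ⟨
    (- + suc e + + suc e) * rising (- + suc e) e ∎
  factorial*C≡rising (suc e) (suc m) = begin
    + (suc e ! ℕ.* (suc m C suc e))                ≡⟨ cong +_ absorb ⟩
    + (suc m ℕ.* (e ! ℕ.* (m C e)))                ≡⟨ pos-* (suc m) (e ! ℕ.* (m C e)) ⟩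
    + suc m * + (e ! ℕ.* (m C e))                  ≡⟨ cong (+ suc m *_) (factorial*C≡rising e m) ⟩
    + suc m * rising (+ m - + e) e               ≡⟨ cong₂ (λ a b → a * rising b e) (lemma₁ 1ℤ (+ m) (+ e)) (lemma₂ 1ℤ (+ m) (+ e)) ⟩
    (+ suc m - + suc e + + suc e) * rising (+ suc m - + suc e) e ∎
    where
    absorb : suc e ! ℕ.* (suc m C suc e) ≡ suc m ℕ.* (e ! ℕ.* (m C e))
    absorb = begin
      (suc e ℕ.* e !) ℕ.* (suc m C suc e)     ≡⟨ swap₁ (suc e) (e !) (suc m C suc e) ⟩
      e ! ℕ.* (suc e ℕ.* (suc m C suc e))     ≡⟨ cong (e ! ℕ.*_) ([k+1]*[n+1]C[k+1]≡[n+1]*nCk m e) ⟩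
      e ! ℕ.* (suc m ℕ.* (m C e))             ≡⟨ swap₂ (e !) (suc m) (m C e) ⟩
      suc m ℕ.* (e ! ℕ.* (m C e))             ∎
      where
      swap₁ : ∀ a b c → (a ℕ.* b) ℕ.* c ≡ b ℕ.* (a ℕ.* c)
      swap₁ = ℕ-Solver.solve-∀
      swap₂ : ∀ a b c → a ℕ.* (b ℕ.* c) ≡ b ℕ.* (a ℕ.* c)
      swap₂ = ℕ-Solver.solve-∀
    lemma₁ : ∀ one a b → one + a ≡ one + a - (one + b) + (one + b)
    lemma₁ = solve-∀
    lemma₂ : ∀ one a b → a - b ≡ one + a - (one + b)
    lemma₂ = solve-∀

  factorial*ehrhartBasis : ∀ d k t → k ≤ d →
    + (d ! ℕ.* ehrhartBasis d k t) ≡ sumUpToℤ d (λ j → risingCoeff (- + k) d j * (+ t) ^ j)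
  factorial*ehrhartBasis d k t k≤d = begin
    + (d ! ℕ.* ((t ℕ.+ d ∸ k) C d))     ≡⟨ factorial*C≡rising d (t ℕ.+ d ∸ k) ⟩
    rising (+ (t ℕ.+ d ∸ k) - + d) d  ≡⟨ cong (λ r → rising r d) shift≡ ⟩
    rising (+ t - + k) d              ≡⟨ sumUpToℤ-risingCoeff (- + k) d (+ t) ⟨
    sumUpToℤ d (λ j → risingCoeff (- + k) d j * (+ t) ^ j) ∎
    where
    lemma : ∀ t d k → t + d - k - d ≡ t - k
    lemma = solve-∀
    shift≡ : + (t ℕ.+ d ∸ k) - + d ≡ + t - + k
    shift≡ = begin
      + (t ℕ.+ d ∸ k) - + d     ≡⟨ cong (_- + d) (trans (sym (⊖-≥ (≤-trans k≤d (m≤n+m d t)))) (sym (m-n≡m⊖n (t ℕ.+ d) k))) ⟩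
      + (t ℕ.+ d) - + k - + d   ≡⟨ cong (λ a → a - + k - + d) (pos-+ t d) ⟩
      + t + + d - + k - + d     ≡⟨ lemma (+ t) (+ d) (+ k) ⟩
      + t - + k                 ∎

module NumberCasts where

  open import Defs using (ℤtoℚ; ℕtoℚ; sum1Toℚ)
  open RangeSums using (sum1Toℤ)
  open import Data.Nat as ℕ using (ℕ; zero; suc; NonZero)
  open import Data.Integer as ℤ using (ℤ; +_)
  open import Data.Integer.Properties using (pos-*)
  open import Data.Integer.Tactic.RingSolver using (solve-∀)
  open import Data.Rational using (ℚ; 1ℚ; _+_; _*_; _/_; toℚᵘ)
  open import Data.Rational.Properties
    using (toℚᵘ-injective; toℚᵘ-fromℚᵘ; toℚᵘ-homo-+; toℚᵘ-homo-*; +-comm; *-assoc; *-comm; *-identityˡ; *-zeroʳ; *-distribˡ-+)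
  open import Data.Rational.Unnormalised as ℚᵘ using (mkℚᵘ; *≡*) renaming (_≃_ to _≃ᵘ_)
  import Data.Rational.Unnormalised.Properties as ℚᵘ
  open import Relation.Binary.PropositionalEquality

  pos-^ : ∀ t j → + (t ℕ.^ j) ≡ (+ t) ℤ.^ j
  pos-^ t zero    = refl
  pos-^ t (suc j) = trans (pos-* t (t ℕ.^ j)) (cong (+ t ℤ.*_) (pos-^ t j))

  ℤtoℚ-toℚᵘ : ∀ z → toℚᵘ (ℤtoℚ z) ≃ᵘ mkℚᵘ z 0
  ℤtoℚ-toℚᵘ z = toℚᵘ-fromℚᵘ (mkℚᵘ z 0)

  ℤtoℚ-+ : ∀ a b → ℤtoℚ (a ℤ.+ b) ≡ ℤtoℚ a + ℤtoℚ b
  ℤtoℚ-+ a b = toℚᵘ-injective (begin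
    toℚᵘ (ℤtoℚ (a ℤ.+ b))              ≈⟨ ℤtoℚ-toℚᵘ (a ℤ.+ b) ⟩
    mkℚᵘ (a ℤ.+ b) 0                   ≈⟨ *≡* (lemma a b) ⟩
    mkℚᵘ a 0 ℚᵘ.+ mkℚᵘ b 0             ≈⟨ ℚᵘ.+-cong (ℤtoℚ-toℚᵘ a) (ℤtoℚ-toℚᵘ b) ⟨
    toℚᵘ (ℤtoℚ a) ℚᵘ.+ toℚᵘ (ℤtoℚ b)   ≈⟨ toℚᵘ-homo-+ (ℤtoℚ a) (ℤtoℚ b) ⟨
    toℚᵘ (ℤtoℚ a + ℤtoℚ b)             ∎)
    where
    open ℚᵘ.≃-Reasoning
    lemma : ∀ a b → (a ℤ.+ b) ℤ.* + 1 ≡ (a ℤ.* + 1 ℤ.+ b ℤ.* + 1) ℤ.* + 1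
    lemma = solve-∀

  ℤtoℚ-* : ∀ a b → ℤtoℚ (a ℤ.* b) ≡ ℤtoℚ a * ℤtoℚ b
  ℤtoℚ-* a b = toℚᵘ-injective (begin
    toℚᵘ (ℤtoℚ (a ℤ.* b))              ≈⟨ ℤtoℚ-toℚᵘ (a ℤ.* b) ⟩
    mkℚᵘ (a ℤ.* b) 0                   ≈⟨ ℚᵘ.*-cong (ℤtoℚ-toℚᵘ a) (ℤtoℚ-toℚᵘ b) ⟨
    toℚᵘ (ℤtoℚ a) ℚᵘ.* toℚᵘ (ℤtoℚ b)   ≈⟨ toℚᵘ-homo-* (ℤtoℚ a) (ℤtoℚ b) ⟨
    toℚᵘ (ℤtoℚ a * ℤtoℚ b)             ∎)
    where open ℚᵘ.≃-Reasoning

  ℕtoℚ-*-inverse : ∀ n .{{_ : NonZero n}} → ℕtoℚ n * (+ 1 / n) ≡ 1ℚ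
  ℕtoℚ-*-inverse (suc n) = toℚᵘ-injective (begin
    toℚᵘ (ℕtoℚ (suc n) * (+ 1 / suc n))                  ≈⟨ toℚᵘ-homo-* (ℕtoℚ (suc n)) (+ 1 / suc n) ⟩
    toℚᵘ (ℕtoℚ (suc n)) ℚᵘ.* toℚᵘ (+ 1 / suc n)          ≈⟨ ℚᵘ.*-cong (ℤtoℚ-toℚᵘ (+ suc n)) (toℚᵘ-fromℚᵘ (mkℚᵘ (+ 1) n)) ⟩
    mkℚᵘ (+ suc n) 0 ℚᵘ.* ℚᵘ.1/ mkℚᵘ (+ suc n) 0         ≈⟨ ℚᵘ.*-inverseʳ (mkℚᵘ (+ suc n) 0) ⟩
    toℚᵘ 1ℚ                                              ∎)
    where open ℚᵘ.≃-Reasoning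

  ℤtoℚ-sum1Toℤ : ∀ K (f : ℕ → ℤ) → ℤtoℚ (sum1Toℤ K f) ≡ sum1Toℚ K (λ j → ℤtoℚ (f j))
  ℤtoℚ-sum1Toℤ zero    f = refl
  ℤtoℚ-sum1Toℤ (suc K) f = trans (ℤtoℚ-+ (sum1Toℤ K f) (f (suc K))) (cong (_+ ℤtoℚ (f (suc K))) (ℤtoℚ-sum1Toℤ K f))

  sum1Toℚ-*ˡ : ∀ K c (f : ℕ → ℚ) → sum1Toℚ K (λ j → c * f j) ≡ c * sum1Toℚ K f
  sum1Toℚ-*ˡ zero    c f = sym (*-zeroʳ c)
  sum1Toℚ-*ˡ (suc K) c f =
    trans (cong (_+ c * f (suc K)) (sum1Toℚ-*ˡ K c f)) (sym (*-distribˡ-+ c (sum1Toℚ K f) (f (suc K))))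

  sum1Toℚ-cong : ∀ K {f g : ℕ → ℚ} → (∀ j → f j ≡ g j) → sum1Toℚ K f ≡ sum1Toℚ K g
  sum1Toℚ-cong zero    f≗g = refl
  sum1Toℚ-cong (suc K) f≗g = cong₂ _+_ (sum1Toℚ-cong K f≗g) (f≗g (suc K))

  ℤtoℚ-divide : ∀ n .{{_ : NonZero n}} X S → + n ℤ.* X ≡ + n ℤ.+ S → ℤtoℚ X ≡ (+ 1 / n) * ℤtoℚ S + 1ℚ
  ℤtoℚ-divide n X S n*X≡n+S = begin
    ℤtoℚ X                            ≡⟨ *-identityˡ (ℤtoℚ X) ⟨
    1ℚ * ℤtoℚ X                       ≡⟨ cong (_* ℤtoℚ X) inverse ⟨
    (n⁻¹ * ℕtoℚ n) * ℤtoℚ X           ≡⟨ *-assoc n⁻¹ (ℕtoℚ n) (ℤtoℚ X) ⟩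
    n⁻¹ * (ℕtoℚ n * ℤtoℚ X)           ≡⟨ cong (n⁻¹ *_) (ℤtoℚ-* (+ n) X) ⟨
    n⁻¹ * ℤtoℚ (+ n ℤ.* X)            ≡⟨ cong (λ z → n⁻¹ * ℤtoℚ z) n*X≡n+S ⟩
    n⁻¹ * ℤtoℚ (+ n ℤ.+ S)            ≡⟨ cong (n⁻¹ *_) (ℤtoℚ-+ (+ n) S) ⟩
    n⁻¹ * (ℕtoℚ n + ℤtoℚ S)           ≡⟨ *-distribˡ-+ n⁻¹ (ℕtoℚ n) (ℤtoℚ S) ⟩
    n⁻¹ * ℕtoℚ n + n⁻¹ * ℤtoℚ S       ≡⟨ +-comm (n⁻¹ * ℕtoℚ n) (n⁻¹ * ℤtoℚ S) ⟩
    n⁻¹ * ℤtoℚ S + n⁻¹ * ℕtoℚ n       ≡⟨ cong (_+_ (n⁻¹ * ℤtoℚ S)) inverse ⟩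
    n⁻¹ * ℤtoℚ S + 1ℚ                 ∎
    where
    open ≡-Reasoning
    n⁻¹ : ℚ
    n⁻¹ = + 1 / n
    inverse : n⁻¹ * ℕtoℚ n ≡ 1ℚ
    inverse = trans (*-comm n⁻¹ (ℕtoℚ n)) (ℕtoℚ-*-inverse n)

module EhrhartPolynomials where

  open import Defs using (sumUpToℤ; ehrSeries; hstarCoeff; ℤtoℚ; ℕtoℚ; sum1Toℚ)
  open RangeSums
  open Binomials using (ehrhartBasis)
  open FiniteDifferences using (Δ^; Δ^-expansion; alternatingSum≡Δ^)
  open RisingFactorials
  open NumberCasts
  open import Data.Nat as ℕ using (ℕ; zero; suc; _<_; _!; s≤s; z≤n)
  open import Data.Nat.Properties using (_!≢0)
  open import Data.Integer using (ℤ; +_; 0ℤ; 1ℤ; _+_; _*_; -_; _^_)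
  open import Data.Integer.Properties using (*-identityʳ; *-zeroʳ; +-identityʳ; *-assoc; pos-*)
  open import Data.Integer.Tactic.RingSolver using (solve-∀)
  open import Data.Rational as ℚ using (ℚ; 1ℚ; _/_)
  import Data.Rational.Properties as ℚ
  open import Relation.Binary.PropositionalEquality
  open ≡-Reasoning

  ehrhartFromHstar : ℕ → (ℕ → ℤ) → ℕ → ℤ
  ehrhartFromHstar d h t = sumUpToℤ d (λ k → h k * + ehrhartBasis d k t)

  ehrSeries≡ehrhartFromHstar : ∀ d L → (∀ k → d < k → hstarCoeff d L k ≡ 0ℤ) →
    ∀ t → ehrSeries L t ≡ ehrhartFromHstar d (hstarCoeff d L) t
  ehrSeries≡ehrhartFromHstar d L vanish t =
    trans (Δ^-expansion d (ehrSeries L) (λ k d<k → trans (sym (Δ^≡h* k)) (vanish k d<k)) t)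
          (sumUpToℤ-cong d (λ k → cong (_* + ehrhartBasis d k t) (sym (Δ^≡h* k))))
    where
    Δ^≡h* : ∀ k → hstarCoeff d L k ≡ Δ^ (suc d) (ehrSeries L) k
    Δ^≡h* = alternatingSum≡Δ^ (suc d) (ehrSeries L)

  powerCoeff : ℕ → (ℕ → ℤ) → ℕ → ℤ
  powerCoeff d h j = sumUpToℤ d (λ k → h k * risingCoeff (- + k) d j)

  factorial*ehrhartFromHstar : ∀ d h t →
    + (d !) * ehrhartFromHstar d h t ≡ sumUpToℤ d (λ j → powerCoeff d h j * (+ t) ^ j)
  factorial*ehrhartFromHstar d h t = begin
    + (d !) * sumUpToℤ d (λ k → h k * + ehrhartBasis d k t)
      ≡⟨ sumUpToℤ-*ˡ d (+ (d !)) _ ⟨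
    sumUpToℤ d (λ k → + (d !) * (h k * + ehrhartBasis d k t))
      ≡⟨ sumUpToℤ-cong≤ d (λ k k≤d → trans (lemma (+ (d !)) (h k) _)
                                     (cong (h k *_) (trans (sym (pos-* (d !) _)) (factorial*ehrhartBasis d k t k≤d)))) ⟩
    sumUpToℤ d (λ k → h k * sumUpToℤ d (λ j → risingCoeff (- + k) d j * (+ t) ^ j))
      ≡⟨ sumUpToℤ-cong d (λ k → sumUpToℤ-*ˡ d (h k) _) ⟨
    sumUpToℤ d (λ k → sumUpToℤ d (λ j → h k * (risingCoeff (- + k) d j * (+ t) ^ j)))
      ≡⟨ sumUpToℤ-swap d d _ ⟩
    sumUpToℤ d (λ j → sumUpToℤ d (λ k → h k * (risingCoeff (- + k) d j * (+ t) ^ j)))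
      ≡⟨ sumUpToℤ-cong d (λ j → trans (sumUpToℤ-cong d (λ k → sym (*-assoc (h k) _ _))) (sumUpToℤ-*ʳ d _ ((+ t) ^ j))) ⟩
    sumUpToℤ d (λ j → powerCoeff d h j * (+ t) ^ j) ∎
    where
    lemma : ∀ c a b → c * (a * b) ≡ a * (c * b)
    lemma = solve-∀

  powerCoeff-top : ∀ d h → powerCoeff d h d ≡ sumUpToℤ d h
  powerCoeff-top d h = sumUpToℤ-cong d (λ k → trans (cong (h k *_) (risingCoeff-top (- + k) d)) (*-identityʳ (h k)))

  powerCoeff-0 : ∀ d h → powerCoeff d h 0 ≡ h 0 * + (d !)
  powerCoeff-0 zero    h = refl
  powerCoeff-0 (suc d) h = begin
    sumUpToℤ (suc d) (λ k → h k * risingCoeff (- + k) (suc d) 0)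
      ≡⟨ sumUpToℤ-suc d _ ⟩
    h 0 * risingCoeff 0ℤ (suc d) 0 + sumUpToℤ d (λ k → h (suc k) * risingCoeff (- + suc k) (suc d) 0)
      ≡⟨ cong₂ _+_ (cong (h 0 *_) (trans (risingCoeff-0 0ℤ (suc d)) (rising-0 (suc d))))
                   (sumUpToℤ-≡0 d (λ k k≤d → trans (cong (h (suc k) *_) (trans (risingCoeff-0 (- + suc k) (suc d)) (rising-neg (suc d) (s≤s z≤n) (s≤s k≤d))))
                                                    (*-zeroʳ (h (suc k))))) ⟩
    h 0 * + (suc d !) + 0ℤ
      ≡⟨ +-identityʳ _ ⟩
    h 0 * + (suc d !) ∎

  factorial*ehrhartFromHstar-normalised : ∀ D T t → T 0 ≡ 1ℤ → sumUpToℤ (suc D) T ≡ 0ℤ →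
    + (suc D !) * ehrhartFromHstar (suc D) T t
      ≡ + (suc D !) + sum1Toℤ D (λ j → powerCoeff (suc D) T j * (+ t) ^ j)
  factorial*ehrhartFromHstar-normalised D T t T₀≡1 ΣT≡0 = begin
    + (d !) * ehrhartFromHstar d T t
      ≡⟨ factorial*ehrhartFromHstar d T t ⟩
    sumUpToℤ d (λ j → powerCoeff d T j * (+ t) ^ j)
      ≡⟨ sumUpToℤ-split D _ ⟩
    powerCoeff d T 0 * 1ℤ + σ + powerCoeff d T d * (+ t) ^ d
      ≡⟨ cong₂ (λ c₀ c_d → c₀ * 1ℤ + σ + c_d * (+ t) ^ d)
               (trans (powerCoeff-0 d T) (cong (_* + (d !)) T₀≡1)) (trans (powerCoeff-top d T) ΣT≡0) ⟩
    1ℤ * + (d !) * 1ℤ + σ + 0ℤ * (+ t) ^ d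
      ≡⟨ lemma (+ (d !)) σ ((+ t) ^ d) ⟩
    + (d !) + σ ∎
    where
    d : ℕ
    d = suc D
    σ : ℤ
    σ = sum1Toℤ D (λ j → powerCoeff d T j * (+ t) ^ j)
    lemma : ∀ n s x → 1ℤ * n * 1ℤ + s + 0ℤ * x ≡ n + s
    lemma = solve-∀

  ehrhartCoeff : ℕ → (ℕ → ℤ) → ℕ → ℚ
  ehrhartCoeff d T j = (+ 1 / d !) {{d !≢0}} ℚ.* ℤtoℚ (powerCoeff d T j)

  ehrhartFromHstar-polynomial : ∀ D T t → T 0 ≡ 1ℤ → sumUpToℤ (suc D) T ≡ 0ℤ →
    ℤtoℚ (ehrhartFromHstar (suc D) T t) ≡ sum1Toℚ D (λ j → ehrhartCoeff (suc D) T j ℚ.* ℕtoℚ (t ℕ.^ j)) ℚ.+ 1ℚ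
  ehrhartFromHstar-polynomial D T t T₀≡1 ΣT≡0 = begin
    ℤtoℚ (ehrhartFromHstar d T t)
      ≡⟨ ℤtoℚ-divide (d !) {{d !≢0}} _ (sum1Toℤ D f) (factorial*ehrhartFromHstar-normalised D T t T₀≡1 ΣT≡0) ⟩
    d!⁻¹ ℚ.* ℤtoℚ (sum1Toℤ D f) ℚ.+ 1ℚ
      ≡⟨ cong (λ z → d!⁻¹ ℚ.* z ℚ.+ 1ℚ) (ℤtoℚ-sum1Toℤ D f) ⟩
    d!⁻¹ ℚ.* sum1Toℚ D (λ j → ℤtoℚ (f j)) ℚ.+ 1ℚ
      ≡⟨ cong (ℚ._+ 1ℚ) (sum1Toℚ-*ˡ D d!⁻¹ _) ⟨
    sum1Toℚ D (λ j → d!⁻¹ ℚ.* ℤtoℚ (f j)) ℚ.+ 1ℚ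
      ≡⟨ cong (ℚ._+ 1ℚ) (sum1Toℚ-cong D term) ⟩
    sum1Toℚ D (λ j → ehrhartCoeff d T j ℚ.* ℕtoℚ (t ℕ.^ j)) ℚ.+ 1ℚ ∎
    where
    d : ℕ
    d = suc D
    d!⁻¹ : ℚ
    d!⁻¹ = (+ 1 / d !) {{d !≢0}}
    f : ℕ → ℤ
    f j = powerCoeff d T j * (+ t) ^ j
    term : ∀ j → d!⁻¹ ℚ.* ℤtoℚ (f j) ≡ ehrhartCoeff d T j ℚ.* ℕtoℚ (t ℕ.^ j)
    term j = begin
      d!⁻¹ ℚ.* ℤtoℚ (powerCoeff d T j * (+ t) ^ j)            ≡⟨ cong (d!⁻¹ ℚ.*_) (ℤtoℚ-* (powerCoeff d T j) _) ⟩
      d!⁻¹ ℚ.* (ℤtoℚ (powerCoeff d T j) ℚ.* ℤtoℚ ((+ t) ^ j)) ≡⟨ cong (λ z → d!⁻¹ ℚ.* (ℤtoℚ (powerCoeff d T j) ℚ.* ℤtoℚ z)) (pos-^ t j) ⟨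
      d!⁻¹ ℚ.* (ℤtoℚ (powerCoeff d T j) ℚ.* ℕtoℚ (t ℕ.^ j))   ≡⟨ ℚ.*-assoc d!⁻¹ _ _ ⟨
      ehrhartCoeff d T j ℚ.* ℕtoℚ (t ℕ.^ j)                   ∎

module EulerianSimplexFamilies where

  open import Defs using (sumUpToℤ; hstarCoeff; ehrSeries; IsEulerianCoeff)
  open RangeSums
  open Binomials using (ehrhartBasis)
  open EulerianNumbers using (worpitzky; eulerianCoeff-0; eulerianCoeff-beyond)
  open EhrhartPolynomials using (ehrhartFromHstar; ehrSeries≡ehrhartFromHstar)
  open import Data.Nat as ℕ using (ℕ; suc; _<_)
  open import Data.Integer using (ℤ; +_; 0ℤ; 1ℤ; _+_; _*_)
  open import Data.Integer.Properties using (+-identityˡ; *-zeroʳ; pos-*)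
  open import Data.Integer.Tactic.RingSolver using (solve-∀)
  open import Relation.Binary.PropositionalEquality
  open ≡-Reasoning

  eulerianHstar⇒T₀≡1 : ∀ {d a₀ T₀} m L → IsEulerianCoeff d 0 a₀ → hstarCoeff d L 0 ≡ + m * + a₀ + T₀ → T₀ ≡ 1ℤ
  eulerianHstar⇒T₀≡1 {d} {a₀} {T₀} m L a₀-eulerian hstar₀ = begin
    T₀               ≡⟨ +-identityˡ T₀ ⟨
    0ℤ + T₀          ≡⟨ cong (_+ T₀) (*-zeroʳ (+ m)) ⟨
    + m * 0ℤ + T₀    ≡⟨ cong (λ n → + m * + n + T₀) (eulerianCoeff-0 a₀-eulerian) ⟨
    + m * + a₀ + T₀  ≡⟨ hstar₀ ⟨
    hstarCoeff d L 0 ≡⟨⟩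
    1ℤ               ∎

  eulerianHstar⇒ehrhart : ∀ D (a : ℕ → ℕ) (T : ℕ → ℤ) m (L : ℕ → ℕ) →
    (∀ k → IsEulerianCoeff (suc D) k (a k)) → (∀ k → suc D < k → T k ≡ 0ℤ) →
    (∀ k → hstarCoeff (suc D) L k ≡ + m * + a k + T k) →
    ∀ t → + L (suc t) ≡ + (m ℕ.* suc t ℕ.^ suc D) + ehrhartFromHstar (suc D) T (suc t)
  eulerianHstar⇒ehrhart D a T m L a-eulerian T-vanish hstar t = begin
    ehrSeries L (suc t)
      ≡⟨ ehrSeries≡ehrhartFromHstar d L hstar-vanish (suc t) ⟩
    sumUpToℤ d (λ k → hstarCoeff d L k * B k)
      ≡⟨ sumUpToℤ-cong d (λ k → trans (cong (_* B k) (hstar k)) (distrib (+ m) (+ a k) (T k) (B k))) ⟩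
    sumUpToℤ d (λ k → + m * (+ a k * B k) + T k * B k)
      ≡⟨ sumUpToℤ-+ d _ _ ⟩
    sumUpToℤ d (λ k → + m * (+ a k * B k)) + ehrhartFromHstar d T (suc t)
      ≡⟨ cong (_+ ehrhartFromHstar d T (suc t)) (sumUpToℤ-*ˡ d (+ m) _) ⟩
    + m * sumUpToℤ d (λ k → + a k * B k) + ehrhartFromHstar d T (suc t)
      ≡⟨ cong (λ z → + m * z + ehrhartFromHstar d T (suc t)) (worpitzky D t a a-eulerian) ⟩
    + m * + (suc t ℕ.^ d) + ehrhartFromHstar d T (suc t)
      ≡⟨ cong (_+ ehrhartFromHstar d T (suc t)) (pos-* m (suc t ℕ.^ d)) ⟨
    + (m ℕ.* suc t ℕ.^ d) + ehrhartFromHstar d T (suc t) ∎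
    where
    d : ℕ
    d = suc D
    B : ℕ → ℤ
    B k = + ehrhartBasis d k (suc t)
    distrib : ∀ m a T b → (m * a + T) * b ≡ m * (a * b) + T * b
    distrib = solve-∀
    hstar-vanish : ∀ k → d < k → hstarCoeff d L k ≡ 0ℤ
    hstar-vanish k d<k = begin
      hstarCoeff d L k     ≡⟨ hstar k ⟩
      + m * + a k + T k    ≡⟨ cong₂ (λ x y → + m * + x + y) (eulerianCoeff-beyond d<k (a-eulerian k)) (T-vanish k d<k) ⟩
      + m * 0ℤ + 0ℤ        ≡⟨ cong (_+ 0ℤ) (*-zeroʳ (+ m)) ⟩
      0ℤ                   ∎

open import Defs
open import Data.Nat using (ℕ; _≤_; _*_; _^_; _∸_)
open import Data.Rational using (ℚ; 1ℚ; _+_) renaming (_*_ to _*ℚ_)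
open import Data.Product using (Σ)
open import Relation.Binary.PropositionalEquality using (_≡_)
open import Data.Nat using (suc; s≤s; z≤n)
open import Data.Integer as ℤ using (1ℤ; +_)
import Data.Rational.Properties as ℚ
open import Data.Product using (_,_)
open import Relation.Binary.PropositionalEquality using (cong; module ≡-Reasoning)
open NumberCasts using (ℤtoℚ-+)
open EhrhartPolynomials using (ehrhartFromHstar; ehrhartCoeff; ehrhartFromHstar-polynomial)
open EulerianSimplexFamilies using (eulerianHstar⇒T₀≡1; eulerianHstar⇒ehrhart)

proposition6p7 : (d : ℕ) → 1 ≤ d →
    (R : ℕ → Simplex d) →
    (i : ℕ → ℕ → ℕ) → (∀ m t → 1 ≤ m → 1 ≤ t → IsEhrhartValue (R m) t (i m t)) →
    (a : ℕ → ℕ) → (∀ k → IsEulerianCoeff d k (a k)) →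
    IsEulerianSimplexFamily d R i a →
    Σ (ℕ → ℚ) λ c →
      ∀ m t → 1 ≤ m → 1 ≤ t →
        ℕtoℚ (i m t) ≡ ℕtoℚ (m * t ^ d) + sum1Toℚ (d ∸ 1) (λ j → c j *ℚ ℕtoℚ (t ^ j)) + 1ℚ
proposition6p7 (suc D) _ _ i _ a a-eulerian (_ , T , T-vanish , ΣT≡0 , hstar) =
  ehrhartCoeff (suc D) T , ehrhart-polynomial
  where
  open ≡-Reasoning
  T₀≡1 : T 0 ≡ 1ℤ
  T₀≡1 = eulerianHstar⇒T₀≡1 1 (i 1) (a-eulerian 0) (hstar 1 (s≤s z≤n) 0)
  ehrhart-polynomial : ∀ m t → 1 ≤ m → 1 ≤ t →
    ℕtoℚ (i m t) ≡ ℕtoℚ (m * t ^ suc D) + sum1Toℚ D (λ j → ehrhartCoeff (suc D) T j *ℚ ℕtoℚ (t ^ j)) + 1ℚ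
  ehrhart-polynomial m (suc t) m≥1 _ = begin
    ℕtoℚ (i m (suc t))
      ≡⟨ cong ℤtoℚ (eulerianHstar⇒ehrhart D a T m (i m) a-eulerian T-vanish (hstar m m≥1) t) ⟩
    ℤtoℚ (+ (m * suc t ^ suc D) ℤ.+ ehrhartFromHstar (suc D) T (suc t))
      ≡⟨ ℤtoℚ-+ (+ (m * suc t ^ suc D)) (ehrhartFromHstar (suc D) T (suc t)) ⟩
    ℕtoℚ (m * suc t ^ suc D) + ℤtoℚ (ehrhartFromHstar (suc D) T (suc t))
      ≡⟨ cong (_+_ (ℕtoℚ (m * suc t ^ suc D))) (ehrhartFromHstar-polynomial D T (suc t) T₀≡1 ΣT≡0) ⟩
    ℕtoℚ (m * suc t ^ suc D) + (σ + 1ℚ)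
      ≡⟨ ℚ.+-assoc (ℕtoℚ (m * suc t ^ suc D)) σ 1ℚ ⟨
    ℕtoℚ (m * suc t ^ suc D) + σ + 1ℚ ∎
    where
    σ : ℚ
    σ = sum1Toℚ D (λ j → ehrhartCoeff (suc D) T j *ℚ ℕtoℚ (suc t ^ j))
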